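{- Let $\mathcal{T}$ be a forest whose components are pairwise disjoint perfect trees. Let $T_1,T_2$ be two components of $\mathcal{T}$ with the same arity $r$, having $h_1$ and $h_2$ levels respectively, where $h_1<h_2$. Let $\ell_1$ be a leaf of $T_1$ and $\ell_2$ a leaf of $T_2$, and let $k\ge1$ be an integer. If $h_1$ is even, then $|\mathcal{I}_{\mathcal{T}}^k(\ell_1)|\le|\mathcal{I}_{\mathcal{T}}^k(\ell_2)|$. If $h_1$ is odd, then $|\mathcal{I}_{\mathcal{T}}^k(\ell_1)|\ge|\mathcal{I}_{\mathcal{T}}^k(\ell_2)|$.
   Context: For an integer $r\ge 2$, the perfect $r$-ary tree with $h$ levels is the rooted tree in which every non-leaf vertex has exactly $r$ children and which has exactly $r^{h-1}$ leaves, all at distance $h-1$ from the root; its arity is $r$, and its leaves are the vertices at distance $h-1$ from the root. A perfect tree is a perfect $r$-ary tree for some $r\ge2$. For a graph $G$, a set $I\subseteq V(G)$ is independent if no two vertices of $I$ are adjacent; $\mathcal{I}_G^k$ denotes the family of all independent sets of size $k$ in $G$, and for $v\in V(G)$, $\mathcal{I}_G^k(v)=\{A\in\mathcal{I}_G^k : v\in A\}$. -}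

module Defs where

open import Data.Nat using (ℕ; zero; suc; _+_; _<_; _≤_; _∸_; _≡ᵇ_)
open import Data.Nat.Properties using () renaming (_≟_ to _≟ℕ_)
open import Data.Bool using (Bool; true; false; _∧_; _∨_; not)
open import Data.List using (List; []; _∷_; _++_; [_]; map; concat; concatMap; upTo; length; take; filterᵇ)
open import Data.Bool.ListAction using (any; all)
open import Data.List.Properties using (≡-dec)
open import Data.Product using (_×_; _,_; proj₁; proj₂)
open import Relation.Nullary using (does)
open import Relation.Binary.PropositionalEquality using (_≡_)
open import Data.List.Relation.Unary.All using (All)

-- A vertex of the forest: (index of the component, path from the root of
-- that component), a path being the list of child indices (each < arity).
Vertex : Set
Vertex = ℕ × List ℕ

-- A forest of perfect trees is described by the list of its components,
-- each given as (arity r, number of levels h).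
Forest : Set
Forest = List (ℕ × ℕ)

pathsOfLen : ℕ → ℕ → List (List ℕ)
pathsOfLen r zero    = [ [] ]
pathsOfLen r (suc n) = concatMap (λ p → map (λ c → p ++ [ c ]) (upTo r)) (pathsOfLen r n)

treeVertices : ℕ → ℕ → List (List ℕ)
treeVertices r h = concatMap (pathsOfLen r) (upTo h)

verticesFrom : ℕ → Forest → List Vertex
verticesFrom i []             = []
verticesFrom i ((r , h) ∷ F)  = map (λ p → (i , p)) (treeVertices r h) ++ verticesFrom (suc i) F

vertices : Forest → List Vertex
vertices = verticesFrom 0

eqL : List ℕ → List ℕ → Bool
eqL p q = does (≡-dec _≟ℕ_ p q)

eqV : Vertex → Vertex → Bool
eqV (i , p) (j , q) = (i ≡ᵇ j) ∧ eqL p q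

parentᵇ : List ℕ → List ℕ → Bool
parentᵇ p q = (length q ≡ᵇ suc (length p)) ∧ eqL (take (length p) q) p

adj : Vertex → Vertex → Bool
adj (i , p) (j , q) = (i ≡ᵇ j) ∧ (parentᵇ p q ∨ parentᵇ q p)

independent : List Vertex → Bool
independent S = all (λ u → all (λ v → not (adj u v)) S) S

sublists : {A : Set} → List A → List (List A)
sublists []       = [ [] ]
sublists (x ∷ xs) = map (x ∷_) (sublists xs) ++ sublists xs

indepSetsContaining : Forest → ℕ → Vertex → List (List Vertex)
indepSetsContaining F k v =
  filterᵇ (λ S → (length S ≡ᵇ k) ∧ any (eqV v) S ∧ independent S) (sublists (vertices F))

numIndep : Forest → ℕ → Vertex → ℕ
numIndep F k v = length (indepSetsContaining F k v)

ValidComponent : ℕ × ℕ → Set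
ValidComponent (r , h) = (2 ≤ r) × (1 ≤ h)

IsLeaf : ℕ → ℕ → List ℕ → Set
IsLeaf r h ℓ = (length ℓ ≡ h ∸ 1) × All (_< r) ℓ

module Submission where

-- Let P_T and L_T be the generating polynomials of the independent sets of a
-- tree T, respectively of those containing a fixed leaf. Independent sets of
-- a forest factor over its components, so the independent sets containing a
-- leaf of T₁ are counted by L_{T₁} P_{T₂} Π and those containing a leaf of T₂
-- by P_{T₁} L_{T₂} Π, with Π the product over the other components; it
-- suffices to compare L_{T₁} P_{T₂} and P_{T₁} L_{T₂} coefficientwise.
-- Splitting by the use of the root, P = Q + R and L = K + J, and the r
-- subtrees of the root give Q′ = P^r, R′ = x Q^r, K′ = L P^(r-1) and
-- J′ = x K Q^(r-1). The difference J Q − R K equals x for a single vertex and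
-- changes sign at every level; it decides the base case n = m + 1 of the
-- comparison of L_m (Q_n, R_n) with P_m (K_n, J_n), which the recurrences then
-- carry to all n > m.

open import Defs
open import Data.Nat using (ℕ; _<_; _≤_; _≥_; _%_)
open import Data.Fin using (Fin; toℕ)
open import Data.List using (length; lookup)
open import Data.List.Relation.Unary.All using (All)
open import Data.Product using (_×_; _,_)
open import Relation.Binary.PropositionalEquality using (_≡_)

open import Algebra.Bundles using (CommutativeMonoid; CommutativeSemiring)
import Algebra.Properties.CommutativeSemigroup as CommutativeSemigroupProperties
import Algebra.Solver.Ring.NaturalCoefficients as NaturalCoefficients
open import Data.Bool using (Bool; true; false; _∧_; _∨_; not; if_then_else_; T)
import Data.Bool.Properties as BoolP
open import Data.Bool.ListAction using (any; all)
open import Data.Empty using (⊥-elim)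
import Data.Fin as Fin
open import Data.Fin.Properties using (toℕ-injective)
open import Data.List using (List; []; _∷_; _++_; [_]; map; concatMap; upTo; applyUpTo; take; filterᵇ)
open import Data.List.Effectful using (module MonadProperties)
import Data.List.Properties as ListP
open import Data.List.Membership.Propositional using (_∈_; _∉_)
open import Data.List.Membership.Propositional.Properties using (∈-map⁺; ∈-upTo⁺)
open import Data.List.Relation.Binary.Permutation.Propositional as ↭
  using (_↭_; ↭-refl; ↭-reflexive; ↭-sym; ↭-trans; module PermutationReasoning)
import Data.List.Relation.Binary.Permutation.Propositional.Properties as ↭P
open import Data.List.Relation.Unary.All as All using ([]; _∷_)
import Data.List.Relation.Unary.All.Properties as AllP
open import Data.List.Relation.Unary.AllPairs using ([]; _∷_)
open import Data.List.Relation.Unary.Any using (here; there)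
open import Data.List.Relation.Unary.Unique.Propositional using (Unique)
import Data.List.Relation.Unary.Unique.Propositional.Properties as UniqueP
open import Data.Maybe using (nothing)
open import Data.Nat using (zero; suc; pred; _+_; _≡ᵇ_; s≤s)
open import Data.Nat.DivMod using ([m+n]%n≡m%n)
import Data.Nat.Properties as ℕP
open import Data.Product using (Σ; proj₁; proj₂)
open import Data.Sum using (inj₁; inj₂)
open import Data.Unit using (⊤; tt)
open import Function using (_∘_)
open import Function.Bundles using (mk⇔)
open import Relation.Binary.PropositionalEquality
  using (_≢_; refl; sym; trans; cong; cong₂; subst; subst₂; module ≡-Reasoning)
import Relation.Binary.Reasoning.Setoid as SetoidReasoning
open import Relation.Nullary using (yes)
open import Relation.Nullary.Decidable using (dec-true; dec-false; does-⇔)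

open import Algebra.Properties.CommutativeSemigroup ℕP.+-commutativeSemigroup using (interchange)
private
  module ∧ = CommutativeSemigroupProperties (CommutativeMonoid.commutativeSemigroup BoolP.∧-commutativeMonoid)
  module ∨ = CommutativeSemigroupProperties (CommutativeMonoid.commutativeSemigroup BoolP.∨-commutativeMonoid)

-- Polynomials with coefficients in ℕ

sumBy : {A : Set} → List A → (A → ℕ) → ℕ
sumBy []       f = 0
sumBy (x ∷ xs) f = f x + sumBy xs f

module _ {A : Set} where

  sumBy-++ : (xs ys : List A) (f : A → ℕ) → sumBy (xs ++ ys) f ≡ sumBy xs f + sumBy ys f
  sumBy-++ []       ys f = refl
  sumBy-++ (x ∷ xs) ys f = trans (cong (f x +_) (sumBy-++ xs ys f)) (sym (ℕP.+-assoc (f x) _ _))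

  sumBy-map : {B : Set} (h : B → A) (xs : List B) (f : A → ℕ) → sumBy (map h xs) f ≡ sumBy xs (f ∘ h)
  sumBy-map h []       f = refl
  sumBy-map h (x ∷ xs) f = cong (f (h x) +_) (sumBy-map h xs f)

  sumBy-cong : (xs : List A) {f g : A → ℕ} → (∀ x → f x ≡ g x) → sumBy xs f ≡ sumBy xs g
  sumBy-cong []       f≗g = refl
  sumBy-cong (x ∷ xs) f≗g = cong₂ _+_ (f≗g x) (sumBy-cong xs f≗g)

  sumBy-congᴬ : {xs : List A} {f g : A → ℕ} → All (λ x → f x ≡ g x) xs → sumBy xs f ≡ sumBy xs g
  sumBy-congᴬ []         = refl
  sumBy-congᴬ (fx ∷ fxs) = cong₂ _+_ fx (sumBy-congᴬ fxs)

  sumBy-+ : (xs : List A) (f g : A → ℕ) → sumBy xs (λ x → f x + g x) ≡ sumBy xs f + sumBy xs g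
  sumBy-+ []       f g = refl
  sumBy-+ (x ∷ xs) f g =
    trans (cong (f x + g x +_) (sumBy-+ xs f g)) (interchange (f x) (g x) (sumBy xs f) (sumBy xs g))

  sumBy-zero : (xs : List A) → sumBy xs (λ _ → 0) ≡ 0
  sumBy-zero []       = refl
  sumBy-zero (x ∷ xs) = sumBy-zero xs

  sumBy-if : (b : Bool) (xs : List A) (f : A → ℕ) →
    sumBy xs (λ x → if b then f x else 0) ≡ (if b then sumBy xs f else 0)
  sumBy-if true  xs f = refl
  sumBy-if false xs f = sumBy-zero xs

sumBy-comm : {A B : Set} (xs : List A) (ys : List B) (f : A → B → ℕ) →
  sumBy xs (λ a → sumBy ys (f a)) ≡ sumBy ys (λ b → sumBy xs (λ a → f a b))
sumBy-comm []       ys f = sym (sumBy-zero ys)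
sumBy-comm (x ∷ xs) ys f = begin
  sumBy ys (f x) + sumBy xs (λ a → sumBy ys (f a))        ≡⟨ cong (sumBy ys (f x) +_) (sumBy-comm xs ys f) ⟩
  sumBy ys (f x) + sumBy ys (λ b → sumBy xs (λ a → f a b)) ≡⟨ sumBy-+ ys (f x) _ ⟨
  sumBy ys (λ b → f x b + sumBy xs (λ a → f a b))          ∎
  where open ≡-Reasoning

-- A polynomial is the bag of the exponents of its monomials; two bags are
-- equal when every weighting of the exponents sums alike.
Poly : Set
Poly = List ℕ

infixr 8 _^_
infixl 7 _⊗_
infixl 6 _⊕_
infix  4 _≈_ _≲_

𝟘 𝟙 X : Poly
𝟘 = []
𝟙 = [ 0 ]
X = [ 1 ]

_⊕_ : Poly → Poly → Poly
_⊕_ = _++_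

_⊗_ : Poly → Poly → Poly
[]      ⊗ q = []
(a ∷ p) ⊗ q = map (a +_) q ++ p ⊗ q

_^_ : Poly → ℕ → Poly
p ^ zero  = 𝟙
p ^ suc n = p ⊗ p ^ n

record _≈_ (p q : Poly) : Set where
  constructor mk≈
  field sumBy-≡ : ∀ g → sumBy p g ≡ sumBy q g
open _≈_

sumBy-⊗ : ∀ p q g → sumBy (p ⊗ q) g ≡ sumBy p (λ a → sumBy q (λ b → g (a + b)))
sumBy-⊗ []      q g = refl
sumBy-⊗ (a ∷ p) q g = begin
  sumBy (map (a +_) q ++ p ⊗ q) g      ≡⟨ sumBy-++ (map (a +_) q) (p ⊗ q) g ⟩
  sumBy (map (a +_) q) g + sumBy (p ⊗ q) g ≡⟨ cong₂ _+_ (sumBy-map (a +_) q g) (sumBy-⊗ p q g) ⟩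
  sumBy q (λ b → g (a + b)) + sumBy p (λ a → sumBy q (λ b → g (a + b))) ∎
  where open ≡-Reasoning

≈-refl : ∀ {p} → p ≈ p
≈-refl = mk≈ λ g → refl

≈-reflexive : ∀ {p q} → p ≡ q → p ≈ q
≈-reflexive refl = ≈-refl

≈-sym : ∀ {p q} → p ≈ q → q ≈ p
≈-sym p≈q = mk≈ λ g → sym (sumBy-≡ p≈q g)

≈-trans : ∀ {p q s} → p ≈ q → q ≈ s → p ≈ s
≈-trans p≈q q≈s = mk≈ λ g → trans (sumBy-≡ p≈q g) (sumBy-≡ q≈s g)

⊕-cong : ∀ {p p′ q q′} → p ≈ p′ → q ≈ q′ → p ⊕ q ≈ p′ ⊕ q′
⊕-cong {p} {p′} {q} {q′} p≈p′ q≈q′ = mk≈ λ g → begin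
  sumBy (p ++ q) g            ≡⟨ sumBy-++ p q g ⟩
  sumBy p g + sumBy q g       ≡⟨ cong₂ _+_ (sumBy-≡ p≈p′ g) (sumBy-≡ q≈q′ g) ⟩
  sumBy p′ g + sumBy q′ g     ≡⟨ sumBy-++ p′ q′ g ⟨
  sumBy (p′ ++ q′) g          ∎
  where open ≡-Reasoning

⊗-cong : ∀ {p p′ q q′} → p ≈ p′ → q ≈ q′ → p ⊗ q ≈ p′ ⊗ q′
⊗-cong {p} {p′} {q} {q′} p≈p′ q≈q′ = mk≈ λ g → begin
  sumBy (p ⊗ q) g                                   ≡⟨ sumBy-⊗ p q g ⟩
  sumBy p (λ a → sumBy q (λ b → g (a + b)))         ≡⟨ sumBy-cong p (λ a → sumBy-≡ q≈q′ (λ b → g (a + b))) ⟩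
  sumBy p (λ a → sumBy q′ (λ b → g (a + b)))        ≡⟨ sumBy-≡ p≈p′ _ ⟩
  sumBy p′ (λ a → sumBy q′ (λ b → g (a + b)))       ≡⟨ sumBy-⊗ p′ q′ g ⟨
  sumBy (p′ ⊗ q′) g                                 ∎
  where open ≡-Reasoning

⊕-congˡ : ∀ p {q q′} → q ≈ q′ → p ⊕ q ≈ p ⊕ q′
⊕-congˡ p = ⊕-cong (≈-refl {p})

⊕-congʳ : ∀ {p p′} q → p ≈ p′ → p ⊕ q ≈ p′ ⊕ q
⊕-congʳ q p≈p′ = ⊕-cong p≈p′ (≈-refl {q})

⊗-congˡ : ∀ p {q q′} → q ≈ q′ → p ⊗ q ≈ p ⊗ q′
⊗-congˡ p = ⊗-cong (≈-refl {p})

⊗-congʳ : ∀ {p p′} q → p ≈ p′ → p ⊗ q ≈ p′ ⊗ q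
⊗-congʳ q p≈p′ = ⊗-cong p≈p′ (≈-refl {q})

⊕-assoc : ∀ p q s → (p ⊕ q) ⊕ s ≈ p ⊕ (q ⊕ s)
⊕-assoc p q s = ≈-reflexive (ListP.++-assoc p q s)

⊕-comm : ∀ p q → p ⊕ q ≈ q ⊕ p
⊕-comm p q = mk≈ λ g → trans (sumBy-++ p q g) (trans (ℕP.+-comm (sumBy p g) _) (sym (sumBy-++ q p g)))

⊕-identityˡ : ∀ p → 𝟘 ⊕ p ≈ p
⊕-identityˡ p = ≈-refl

⊕-identityʳ : ∀ p → p ⊕ 𝟘 ≈ p
⊕-identityʳ p = ≈-reflexive (ListP.++-identityʳ p)

⊗-assoc : ∀ p q s → (p ⊗ q) ⊗ s ≈ p ⊗ (q ⊗ s)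
⊗-assoc p q s = mk≈ λ g → begin
  sumBy ((p ⊗ q) ⊗ s) g
    ≡⟨ sumBy-⊗ (p ⊗ q) s g ⟩
  sumBy (p ⊗ q) (λ x → sumBy s (λ c → g (x + c)))
    ≡⟨ sumBy-⊗ p q _ ⟩
  sumBy p (λ a → sumBy q (λ b → sumBy s (λ c → g (a + b + c))))
    ≡⟨ sumBy-cong p (λ a → sumBy-cong q (λ b → sumBy-cong s (λ c → cong g (ℕP.+-assoc a b c)))) ⟩
  sumBy p (λ a → sumBy q (λ b → sumBy s (λ c → g (a + (b + c)))))
    ≡⟨ sumBy-cong p (λ a → sumBy-⊗ q s (λ y → g (a + y))) ⟨
  sumBy p (λ a → sumBy (q ⊗ s) (λ y → g (a + y)))
    ≡⟨ sumBy-⊗ p (q ⊗ s) g ⟨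
  sumBy (p ⊗ (q ⊗ s)) g ∎
  where open ≡-Reasoning

⊗-comm : ∀ p q → p ⊗ q ≈ q ⊗ p
⊗-comm p q = mk≈ λ g → begin
  sumBy (p ⊗ q) g                             ≡⟨ sumBy-⊗ p q g ⟩
  sumBy p (λ a → sumBy q (λ b → g (a + b)))   ≡⟨ sumBy-comm p q _ ⟩
  sumBy q (λ b → sumBy p (λ a → g (a + b)))   ≡⟨ sumBy-cong q (λ b → sumBy-cong p (λ a → cong g (ℕP.+-comm a b))) ⟩
  sumBy q (λ b → sumBy p (λ a → g (b + a)))   ≡⟨ sumBy-⊗ q p g ⟨
  sumBy (q ⊗ p) g                             ∎
  where open ≡-Reasoning

⊗-identityˡ : ∀ p → 𝟙 ⊗ p ≈ p
⊗-identityˡ p = mk≈ λ g → trans (sumBy-⊗ 𝟙 p g) (ℕP.+-identityʳ _)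

⊗-identityʳ : ∀ p → p ⊗ 𝟙 ≈ p
⊗-identityʳ p = ≈-trans (⊗-comm p 𝟙) (⊗-identityˡ p)

⊗-zeroˡ : ∀ p → 𝟘 ⊗ p ≈ 𝟘
⊗-zeroˡ p = ≈-refl

⊗-zeroʳ : ∀ p → p ⊗ 𝟘 ≈ 𝟘
⊗-zeroʳ p = ≈-trans (⊗-comm p 𝟘) (⊗-zeroˡ p)

⊗-distribʳ-⊕ : ∀ s p q → (p ⊕ q) ⊗ s ≈ p ⊗ s ⊕ q ⊗ s
⊗-distribʳ-⊕ s p q = mk≈ λ g → begin
  sumBy ((p ⊕ q) ⊗ s) g                                  ≡⟨ sumBy-⊗ (p ⊕ q) s g ⟩
  sumBy (p ++ q) (λ a → sumBy s (λ b → g (a + b)))       ≡⟨ sumBy-++ p q _ ⟩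
  _                                                      ≡⟨ cong₂ _+_ (sumBy-⊗ p s g) (sumBy-⊗ q s g) ⟨
  sumBy (p ⊗ s) g + sumBy (q ⊗ s) g                      ≡⟨ sumBy-++ (p ⊗ s) (q ⊗ s) g ⟨
  sumBy (p ⊗ s ⊕ q ⊗ s) g                                ∎
  where open ≡-Reasoning

⊗-distribˡ-⊕ : ∀ s p q → s ⊗ (p ⊕ q) ≈ s ⊗ p ⊕ s ⊗ q
⊗-distribˡ-⊕ s p q =
  ≈-trans (⊗-comm s (p ⊕ q)) (≈-trans (⊗-distribʳ-⊕ s p q) (⊕-cong (⊗-comm p s) (⊗-comm q s)))

⊕-⊗-commutativeSemiring : CommutativeSemiring _ _
⊕-⊗-commutativeSemiring = record
  { Carrier = Poly ; _≈_ = _≈_ ; _+_ = _⊕_ ; _*_ = _⊗_ ; 0# = 𝟘 ; 1# = 𝟙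
  ; isCommutativeSemiring = record
    { isSemiring = record
      { isSemiringWithoutAnnihilatingZero = record
        { +-isCommutativeMonoid = record
          { isMonoid = record
            { isSemigroup = record
              { isMagma = record
                { isEquivalence = record { refl = ≈-refl ; sym = ≈-sym ; trans = ≈-trans }
                ; ∙-cong = ⊕-cong }
              ; assoc = ⊕-assoc }
            ; identity = ⊕-identityˡ , ⊕-identityʳ }
          ; comm = ⊕-comm }
        ; *-cong = ⊗-cong
        ; *-assoc = ⊗-assoc
        ; *-identity = ⊗-identityˡ , ⊗-identityʳ
        ; distrib = ⊗-distribˡ-⊕ , ⊗-distribʳ-⊕ }
      ; zero = ⊗-zeroˡ , ⊗-zeroʳ }
    ; *-comm = ⊗-comm } }

open CommutativeSemiring ⊕-⊗-commutativeSemiring using () renaming (setoid to ≈-setoid)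
module ≈-Reasoning = SetoidReasoning ≈-setoid
open NaturalCoefficients ⊕-⊗-commutativeSemiring (λ _ _ → nothing)
  using (solve; _:+_; _:*_; _:=_)

^-cong : ∀ {p q} n → p ≈ q → p ^ n ≈ q ^ n
^-cong zero    p≈q = ≈-refl
^-cong (suc n) p≈q = ⊗-cong p≈q (^-cong n p≈q)

_≲_ : Poly → Poly → Set
p ≲ q = Σ Poly λ d → q ≈ p ⊕ d

≲-resp-≈ : ∀ {p p′ q q′} → p ≈ p′ → q ≈ q′ → p ≲ q → p′ ≲ q′
≲-resp-≈ p≈p′ q≈q′ (d , q≈p+d) = d , ≈-trans (≈-sym q≈q′) (≈-trans q≈p+d (⊕-congʳ d p≈p′))

⊗-monoˡ-≲ : ∀ {p q} s → p ≲ q → p ⊗ s ≲ q ⊗ s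
⊗-monoˡ-≲ {p} s (d , q≈p+d) = d ⊗ s , ≈-trans (⊗-congʳ s q≈p+d) (⊗-distribʳ-⊕ s p d)

coeff : ℕ → Poly → ℕ
coeff k p = sumBy p (λ n → if n ≡ᵇ k then 1 else 0)

coeff-cong : ∀ k {p q} → p ≈ q → coeff k p ≡ coeff k q
coeff-cong k p≈q = sumBy-≡ p≈q _

coeff-mono : ∀ k {p q} → p ≲ q → coeff k p ≤ coeff k q
coeff-mono k {p} (d , q≈p+d) =
  subst (coeff k p ≤_) (sym (trans (coeff-cong k q≈p+d) (sumBy-++ p d _))) (ℕP.m≤m+n _ _)

≲-reflexive : ∀ {p q} → p ≈ q → p ≲ q
≲-reflexive p≈q = 𝟘 , ≈-trans (≈-sym p≈q) (≈-sym (⊕-identityʳ _))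

𝟘-≲ : ∀ p → 𝟘 ≲ p
𝟘-≲ p = p , ≈-refl

⊕-mono-≲ : ∀ {p p′ q q′} → p ≲ p′ → q ≲ q′ → p ⊕ q ≲ p′ ⊕ q′
⊕-mono-≲ {p} {p′} {q} {q′} (d , p′≈p+d) (e , q′≈q+e) =
  d ⊕ e , ≈-trans (⊕-cong p′≈p+d q′≈q+e) (solve 4 (λ p d q e → p :+ d :+ (q :+ e) := p :+ q :+ (d :+ e)) ≈-refl p d q e)

⊗-monoʳ-≲ : ∀ s {p q} → p ≲ q → s ⊗ p ≲ s ⊗ q
⊗-monoʳ-≲ s {p} {q} p≲q = ≲-resp-≈ (⊗-comm p s) (⊗-comm q s) (⊗-monoˡ-≲ s p≲q)

infix 4 _≲[_]_
_≲[_]_ : Poly → Bool → Poly → Set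
p ≲[ true  ] q = p ≲ q
p ≲[ false ] q = q ≲ p

≲[]-reflexive : ∀ b {p q} → p ≈ q → p ≲[ b ] q
≲[]-reflexive true  p≈q = ≲-reflexive p≈q
≲[]-reflexive false p≈q = ≲-reflexive (≈-sym p≈q)

≲[]-resp-≈ : ∀ b {p p′ q q′} → p ≈ p′ → q ≈ q′ → p ≲[ b ] q → p′ ≲[ b ] q′
≲[]-resp-≈ true  p≈p′ q≈q′ = ≲-resp-≈ p≈p′ q≈q′
≲[]-resp-≈ false p≈p′ q≈q′ = ≲-resp-≈ q≈q′ p≈p′

≲[]-flip : ∀ b {p q} → p ≲[ b ] q → q ≲[ not b ] p
≲[]-flip true  p≲q = p≲q
≲[]-flip false q≲p = q≲p

⊕-mono-≲[] : ∀ b {p p′ q q′} → p ≲[ b ] p′ → q ≲[ b ] q′ → p ⊕ q ≲[ b ] p′ ⊕ q′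
⊕-mono-≲[] true  = ⊕-mono-≲
⊕-mono-≲[] false = ⊕-mono-≲

⊗-monoˡ-≲[] : ∀ b s {p q} → p ≲[ b ] q → p ⊗ s ≲[ b ] q ⊗ s
⊗-monoˡ-≲[] true  s = ⊗-monoˡ-≲ s
⊗-monoˡ-≲[] false s = ⊗-monoˡ-≲ s

⊗-monoʳ-≲[] : ∀ b s {p q} → p ≲[ b ] q → s ⊗ p ≲[ b ] s ⊗ q
⊗-monoʳ-≲[] true  s = ⊗-monoʳ-≲ s
⊗-monoʳ-≲[] false s = ⊗-monoʳ-≲ s

module _ {A : Set} where

  all-++ : (f : A → Bool) (xs ys : List A) → all f (xs ++ ys) ≡ all f xs ∧ all f ys
  all-++ f []       ys = refl
  all-++ f (x ∷ xs) ys = trans (cong (f x ∧_) (all-++ f xs ys)) (sym (BoolP.∧-assoc (f x) _ _))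

  any-++ : (f : A → Bool) (xs ys : List A) → any f (xs ++ ys) ≡ any f xs ∨ any f ys
  any-++ f []       ys = refl
  any-++ f (x ∷ xs) ys = trans (cong (f x ∨_) (any-++ f xs ys)) (sym (BoolP.∨-assoc (f x) _ _))

  all-congᴬ : {f g : A → Bool} {xs : List A} → All (λ x → f x ≡ g x) xs → all f xs ≡ all g xs
  all-congᴬ []         = refl
  all-congᴬ (e ∷ es)   = cong₂ _∧_ e (all-congᴬ es)

  all-cong : {f g : A → Bool} (xs : List A) → (∀ x → f x ≡ g x) → all f xs ≡ all g xs
  all-cong xs f≗g = all-congᴬ (All.universal f≗g xs)

  any-cong : {f g : A → Bool} (xs : List A) → (∀ x → f x ≡ g x) → any f xs ≡ any g xs
  any-cong []       f≗g = refl
  any-cong (x ∷ xs) f≗g = cong₂ _∨_ (f≗g x) (any-cong xs f≗g)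

  all-true : {f : A → Bool} {xs : List A} → All (λ x → f x ≡ true) xs → all f xs ≡ true
  all-true []         = refl
  all-true (fx ∷ fxs) rewrite fx = all-true fxs

  all-const-true : (xs : List A) → all (λ _ → true) xs ≡ true
  all-const-true xs = all-true (All.universal (λ _ → refl) xs)

  any-false : {f : A → Bool} {xs : List A} → All (λ x → f x ≡ false) xs → any f xs ≡ false
  any-false []         = refl
  any-false (fx ∷ fxs) rewrite fx = any-false fxs

  all-∧ : (f g : A → Bool) (xs : List A) → all (λ x → f x ∧ g x) xs ≡ all f xs ∧ all g xs
  all-∧ f g []       = refl
  all-∧ f g (x ∷ xs) = trans (cong ((f x ∧ g x) ∧_) (all-∧ f g xs)) (∧.interchange (f x) (g x) _ _)

  all-not : (f : A → Bool) (xs : List A) → all (not ∘ f) xs ≡ not (any f xs)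
  all-not f []       = refl
  all-not f (x ∷ xs) with f x
  ... | true  = refl
  ... | false = all-not f xs

  all-↭ : (f : A → Bool) {xs ys : List A} → xs ↭ ys → all f xs ≡ all f ys
  all-↭ f ↭.refl          = refl
  all-↭ f (↭.prep x p)    = cong (f x ∧_) (all-↭ f p)
  all-↭ f (↭.swap x y p)  = trans (cong (λ b → f x ∧ (f y ∧ b)) (all-↭ f p)) (∧.x∙yz≈y∙xz (f x) (f y) _)
  all-↭ f (↭.trans p q)   = trans (all-↭ f p) (all-↭ f q)

  any-↭ : (f : A → Bool) {xs ys : List A} → xs ↭ ys → any f xs ≡ any f ys
  any-↭ f ↭.refl          = refl
  any-↭ f (↭.prep x p)    = cong (f x ∨_) (any-↭ f p)
  any-↭ f (↭.swap x y p)  = trans (cong (λ b → f x ∨ (f y ∨ b)) (any-↭ f p)) (∨.x∙yz≈y∙xz (f x) (f y) _)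
  any-↭ f (↭.trans p q)   = trans (any-↭ f p) (any-↭ f q)

module _ {A B : Set} (h : A → B) where

  all-map : (f : B → Bool) (xs : List A) → all f (map h xs) ≡ all (f ∘ h) xs
  all-map f []       = refl
  all-map f (x ∷ xs) = cong (f (h x) ∧_) (all-map f xs)

  any-map : (f : B → Bool) (xs : List A) → any f (map h xs) ≡ any (f ∘ h) xs
  any-map f []       = refl
  any-map f (x ∷ xs) = cong (f (h x) ∨_) (any-map f xs)

module _ {A : Set} (adj : A → A → Bool) where

  open ≡-Reasoning

  isIndependent : List A → Bool
  isIndependent S = all (λ u → all (λ w → not (adj u w)) S) S

  isIndependent-↭ : {S S′ : List A} → S ↭ S′ → isIndependent S ≡ isIndependent S′
  isIndependent-↭ {S} p = trans (all-cong S (λ u → all-↭ (λ w → not (adj u w)) p)) (all-↭ _ p)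

  isIndependent-++ : (C D : A → Set) →
    (∀ {u w} → C u → D w → adj u w ≡ false) → (∀ {u w} → D u → C w → adj u w ≡ false) →
    {s t : List A} → All C s → All D t → isIndependent (s ++ t) ≡ isIndependent s ∧ isIndependent t
  isIndependent-++ C D C-D D-C {s} {t} Cs Dt = begin
    all (nonadjTo (s ++ t)) (s ++ t)
      ≡⟨ all-++ (nonadjTo (s ++ t)) s t ⟩
    all (nonadjTo (s ++ t)) s ∧ all (nonadjTo (s ++ t)) t
      ≡⟨ cong₂ _∧_ (all-cong s (λ u → all-++ (nonadj u) s t)) (all-cong t (λ u → all-++ (nonadj u) s t)) ⟩
    all (λ u → all (nonadj u) s ∧ all (nonadj u) t) s ∧ all (λ u → all (nonadj u) s ∧ all (nonadj u) t) t
      ≡⟨ cong₂ _∧_ (all-congᴬ (All.map (λ {u} Cu → trans (cong (all (nonadj u) s ∧_) (all-true (All.map (cong not ∘ C-D Cu) Dt)))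
                                                            (BoolP.∧-identityʳ _)) Cs))
                   (all-congᴬ (All.map (λ {u} Du → cong (_∧ all (nonadj u) t) (all-true (All.map (cong not ∘ D-C Du) Cs))) Dt)) ⟩
    isIndependent s ∧ isIndependent t ∎
    where
    nonadj : A → A → Bool
    nonadj u w = not (adj u w)
    nonadjTo : List A → A → Bool
    nonadjTo S u = all (nonadj u) S

  isIndependent-∷ : ∀ x S → adj x x ≡ false → (∀ u → adj u x ≡ adj x u) →
    isIndependent (x ∷ S) ≡ all (λ w → not (adj x w)) S ∧ isIndependent S
  isIndependent-∷ x S irrefl sym-adj rewrite irrefl = begin
    all N S ∧ all (λ u → not (adj u x) ∧ all (λ w → not (adj u w)) S) S
      ≡⟨ cong (all N S ∧_) (all-cong S (λ u → cong (λ b → not b ∧ all (λ w → not (adj u w)) S) (sym-adj u))) ⟩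
    all N S ∧ all (λ u → N u ∧ all (λ w → not (adj u w)) S) S
      ≡⟨ cong (all N S ∧_) (all-∧ N _ S) ⟩
    all N S ∧ (all N S ∧ isIndependent S)
      ≡⟨ BoolP.∧-assoc (all N S) _ _ ⟨
    (all N S ∧ all N S) ∧ isIndependent S
      ≡⟨ cong (_∧ isIndependent S) (BoolP.∧-idem (all N S)) ⟩
    all N S ∧ isIndependent S ∎
    where
    N : A → Bool
    N w = not (adj x w)

isIndependent-map : {A B : Set} (adj : B → B → Bool) (adj′ : A → A → Bool) (h : A → B) →
  (∀ u w → adj (h u) (h w) ≡ adj′ u w) → (S : List A) → isIndependent adj (map h S) ≡ isIndependent adj′ S
isIndependent-map adj adj′ h h-hom S =
  trans (all-map h _ S) (all-cong S (λ u → trans (all-map h _ S) (all-cong S (λ w → cong not (h-hom u w)))))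

module _ {A : Set} where

  open ≡-Reasoning

  -- gen R xs is the polynomial ∑ x^|S| over the sublists S of xs with R S.
  gen : (List A → Bool) → List A → Poly
  gen R xs = map length (filterᵇ R (sublists xs))

  sumBy-filter : (R : List A → Bool) (Ss : List (List A)) (g : ℕ → ℕ) →
    sumBy (map length (filterᵇ R Ss)) g ≡ sumBy Ss (λ S → if R S then g (length S) else 0)
  sumBy-filter R []       g = refl
  sumBy-filter R (S ∷ Ss) g with R S
  ... | true  = cong (g (length S) +_) (sumBy-filter R Ss g)
  ... | false = sumBy-filter R Ss g

  sumBy-sublists-∷ : (x : A) (xs : List A) (F : List A → ℕ) →
    sumBy (sublists (x ∷ xs)) F ≡ sumBy (sublists xs) (F ∘ (x ∷_)) + sumBy (sublists xs) F
  sumBy-sublists-∷ x xs F =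
    trans (sumBy-++ (map (x ∷_) (sublists xs)) _ F) (cong (_+ _) (sumBy-map (x ∷_) (sublists xs) F))

  sumBy-sublists-++ : (xs ys : List A) (F : List A → ℕ) →
    sumBy (sublists (xs ++ ys)) F ≡ sumBy (sublists xs) (λ s → sumBy (sublists ys) (λ t → F (s ++ t)))
  sumBy-sublists-++ []       ys F = sym (ℕP.+-identityʳ _)
  sumBy-sublists-++ (x ∷ xs) ys F = begin
    sumBy (sublists (x ∷ xs ++ ys)) F
      ≡⟨ sumBy-sublists-∷ x (xs ++ ys) F ⟩
    sumBy (sublists (xs ++ ys)) (F ∘ (x ∷_)) + sumBy (sublists (xs ++ ys)) F
      ≡⟨ cong₂ _+_ (sumBy-sublists-++ xs ys (F ∘ (x ∷_))) (sumBy-sublists-++ xs ys F) ⟩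
    sumBy (sublists xs) (G ∘ (x ∷_)) + sumBy (sublists xs) G
      ≡⟨ sumBy-sublists-∷ x xs G ⟨
    sumBy (sublists (x ∷ xs)) G ∎
    where
    G : List A → ℕ
    G s = sumBy (sublists ys) (λ t → F (s ++ t))

  sumBy-sublists-↭ : {xs ys : List A} → xs ↭ ys → (F : List A → ℕ) → (∀ {S S′} → S ↭ S′ → F S ≡ F S′) →
    sumBy (sublists xs) F ≡ sumBy (sublists ys) F
  sumBy-sublists-↭ ↭.refl F F-↭ = refl
  sumBy-sublists-↭ {x ∷ xs} {x ∷ ys} (↭.prep x p) F F-↭ = begin
    sumBy (sublists (x ∷ xs)) F                                      ≡⟨ sumBy-sublists-∷ x xs F ⟩
    sumBy (sublists xs) (F ∘ (x ∷_)) + sumBy (sublists xs) F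
      ≡⟨ cong₂ _+_ (sumBy-sublists-↭ p (F ∘ (x ∷_)) (F-↭ ∘ ↭.prep x)) (sumBy-sublists-↭ p F F-↭) ⟩
    sumBy (sublists ys) (F ∘ (x ∷_)) + sumBy (sublists ys) F         ≡⟨ sumBy-sublists-∷ x ys F ⟨
    sumBy (sublists (x ∷ ys)) F                                      ∎
  sumBy-sublists-↭ {x ∷ y ∷ xs} {y ∷ x ∷ ys} (↭.swap x y p) F F-↭ = begin
    sumBy (sublists (x ∷ y ∷ xs)) F
      ≡⟨ two x y xs F ⟩
    (∑ xs (λ S → F (x ∷ y ∷ S)) + ∑ xs (F ∘ (x ∷_))) + (∑ xs (F ∘ (y ∷_)) + ∑ xs F)
      ≡⟨ cong₂ _+_ (cong₂ _+_ (trans (sumBy-cong (sublists xs) (λ S → F-↭ (↭.swap x y (↭.refl {xs = S}))))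
                                     (sumBy-sublists-↭ p _ (F-↭ ∘ ↭.prep y ∘ ↭.prep x)))
                              (sumBy-sublists-↭ p _ (F-↭ ∘ ↭.prep x)))
                   (cong₂ _+_ (sumBy-sublists-↭ p _ (F-↭ ∘ ↭.prep y)) (sumBy-sublists-↭ p F F-↭)) ⟩
    (∑ ys (λ S → F (y ∷ x ∷ S)) + ∑ ys (F ∘ (x ∷_))) + (∑ ys (F ∘ (y ∷_)) + ∑ ys F)
      ≡⟨ interchange (∑ ys (λ S → F (y ∷ x ∷ S))) _ _ _ ⟩
    (∑ ys (λ S → F (y ∷ x ∷ S)) + ∑ ys (F ∘ (y ∷_))) + (∑ ys (F ∘ (x ∷_)) + ∑ ys F)
      ≡⟨ two y x ys F ⟨
    sumBy (sublists (y ∷ x ∷ ys)) F ∎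
    where
    ∑ : List A → (List A → ℕ) → ℕ
    ∑ zs = sumBy (sublists zs)
    two : ∀ u v zs G → sumBy (sublists (u ∷ v ∷ zs)) G ≡
      (∑ zs (λ S → G (u ∷ v ∷ S)) + ∑ zs (G ∘ (u ∷_))) + (∑ zs (G ∘ (v ∷_)) + ∑ zs G)
    two u v zs G = trans (sumBy-sublists-∷ u (v ∷ zs) G) (cong₂ _+_ (sumBy-sublists-∷ v zs _) (sumBy-sublists-∷ v zs G))
  sumBy-sublists-↭ (↭.trans p q) F F-↭ = trans (sumBy-sublists-↭ p F F-↭) (sumBy-sublists-↭ q F F-↭)

  All-sublists : {C : A → Set} {xs : List A} → All C xs → All (All C) (sublists xs)
  All-sublists []         = [] ∷ []
  All-sublists (cx ∷ cxs) = AllP.++⁺ (AllP.map⁺ (All.map (cx ∷_) (All-sublists cxs))) (All-sublists cxs)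

  gen-congᴬ : {R R′ : List A → Bool} (xs : List A) → All (λ S → R S ≡ R′ S) (sublists xs) → gen R xs ≈ gen R′ xs
  gen-congᴬ {R} {R′} xs R≗R′ = mk≈ λ g → begin
    sumBy (gen R xs) g                                              ≡⟨ sumBy-filter R (sublists xs) g ⟩
    sumBy (sublists xs) (λ S → if R S then g (length S) else 0)
      ≡⟨ sumBy-congᴬ (All.map (cong (λ b → if b then _ else 0)) R≗R′) ⟩
    sumBy (sublists xs) (λ S → if R′ S then g (length S) else 0)   ≡⟨ sumBy-filter R′ (sublists xs) g ⟨
    sumBy (gen R′ xs) g                                             ∎

  gen-cong : {R R′ : List A → Bool} (xs : List A) → (∀ S → R S ≡ R′ S) → gen R xs ≈ gen R′ xs
  gen-cong xs R≗R′ = gen-congᴬ xs (All.universal R≗R′ (sublists xs))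

  gen-congᶜ : {R R′ : List A → Bool} (C : A → Set) {xs : List A} → All C xs →
    (∀ S → All C S → R S ≡ R′ S) → gen R xs ≈ gen R′ xs
  gen-congᶜ C {xs} Cxs R≗R′ = gen-congᴬ xs (All.map (R≗R′ _) (All-sublists Cxs))

  gen-false : (xs : List A) → gen (λ _ → false) xs ≈ 𝟘
  gen-false xs = mk≈ λ g → trans (sumBy-filter _ (sublists xs) g) (sumBy-zero (sublists xs))

  gen-∷ : (R : List A → Bool) (x : A) (xs : List A) → gen R (x ∷ xs) ≈ X ⊗ gen (R ∘ (x ∷_)) xs ⊕ gen R xs
  gen-∷ R x xs = mk≈ λ g → begin
    sumBy (gen R (x ∷ xs)) g
      ≡⟨ sumBy-filter R (sublists (x ∷ xs)) g ⟩
    sumBy (sublists (x ∷ xs)) (F g)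
      ≡⟨ sumBy-sublists-∷ x xs (F g) ⟩
    sumBy (sublists xs) (F g ∘ (x ∷_)) + sumBy (sublists xs) (F g)
      ≡⟨ cong₂ _+_ (sumBy-filter (R ∘ (x ∷_)) (sublists xs) (g ∘ suc)) (sumBy-filter R (sublists xs) g) ⟨
    sumBy (gen (R ∘ (x ∷_)) xs) (g ∘ suc) + sumBy (gen R xs) g
      ≡⟨ cong (_+ _) (trans (sym (ℕP.+-identityʳ _)) (sym (sumBy-⊗ X (gen (R ∘ (x ∷_)) xs) g))) ⟩
    sumBy (X ⊗ gen (R ∘ (x ∷_)) xs) g + sumBy (gen R xs) g
      ≡⟨ sumBy-++ (X ⊗ gen (R ∘ (x ∷_)) xs) _ g ⟨
    sumBy (X ⊗ gen (R ∘ (x ∷_)) xs ⊕ gen R xs) g ∎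
    where
    F : (ℕ → ℕ) → List A → ℕ
    F g S = if R S then g (length S) else 0

  gen-split : (b R : List A → Bool) (xs : List A) →
    gen R xs ≈ gen (λ S → not (b S) ∧ R S) xs ⊕ gen (λ S → b S ∧ R S) xs
  gen-split b R xs = mk≈ λ g → begin
    sumBy (gen R xs) g
      ≡⟨ sumBy-filter R (sublists xs) g ⟩
    sumBy (sublists xs) (λ S → if R S then g (length S) else 0)
      ≡⟨ sumBy-cong (sublists xs) (λ S → split (b S) (R S) _) ⟩
    sumBy (sublists xs) (λ S → (if not (b S) ∧ R S then g (length S) else 0) + (if b S ∧ R S then g (length S) else 0))
      ≡⟨ sumBy-+ (sublists xs) _ _ ⟩
    _ ≡⟨ cong₂ _+_ (sumBy-filter _ (sublists xs) g) (sumBy-filter _ (sublists xs) g) ⟨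
    sumBy (gen (λ S → not (b S) ∧ R S) xs) g + sumBy (gen (λ S → b S ∧ R S) xs) g
      ≡⟨ sumBy-++ (gen _ xs) _ g ⟨
    sumBy (gen (λ S → not (b S) ∧ R S) xs ⊕ gen (λ S → b S ∧ R S) xs) g ∎
    where
    split : ∀ b r n → (if r then n else 0) ≡ (if not b ∧ r then n else 0) + (if b ∧ r then n else 0)
    split true  r n = refl
    split false r n = sym (ℕP.+-identityʳ _)

  gen-∷-excluded : (R : List A → Bool) (x : A) (xs : List A) → (∀ S → R (x ∷ S) ≡ false) → gen R (x ∷ xs) ≈ gen R xs
  gen-∷-excluded R x xs excluded =
    ≈-trans (gen-∷ R x xs)
            (⊕-congʳ (gen R xs) (≈-trans (⊗-congˡ X (≈-trans (gen-cong xs excluded) (gen-false xs))) (⊗-zeroʳ X)))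

  gen-∷-forced : (R : List A → Bool) (x : A) (C : A → Set) {xs : List A} → All C xs →
    (∀ S → All C S → R S ≡ false) → gen R (x ∷ xs) ≈ X ⊗ gen (R ∘ (x ∷_)) xs
  gen-∷-forced R x C {xs} Cxs forced =
    ≈-trans (gen-∷ R x xs)
            (≈-trans (⊕-congˡ (X ⊗ gen (R ∘ (x ∷_)) xs) (≈-trans (gen-congᶜ C Cxs forced) (gen-false xs))) (⊕-identityʳ _))

  gen-++ : (R R₁ R₂ : List A → Bool) (C D : A → Set) {xs ys : List A} → All C xs → All D ys →
    (∀ {s t} → All C s → All D t → R (s ++ t) ≡ R₁ s ∧ R₂ t) →
    gen R (xs ++ ys) ≈ gen R₁ xs ⊗ gen R₂ ys
  gen-++ R R₁ R₂ C D {xs} {ys} Cxs Dys R-++ = mk≈ λ g → begin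
    sumBy (gen R (xs ++ ys)) g
      ≡⟨ sumBy-filter R (sublists (xs ++ ys)) g ⟩
    sumBy (sublists (xs ++ ys)) (λ S → if R S then g (length S) else 0)
      ≡⟨ sumBy-sublists-++ xs ys _ ⟩
    sumBy (sublists xs) (λ s → sumBy (sublists ys) (λ t → if R (s ++ t) then g (length (s ++ t)) else 0))
      ≡⟨ sumBy-congᴬ (All.map (λ {s} Cs → sumBy-congᴬ (All.map (λ {t} Dt →
           trans (cong₂ (λ b n → if b then g n else 0) (R-++ Cs Dt) (ListP.length-++ s)) (if-∧ (R₁ s) (R₂ t) _))
           (All-sublists Dys))) (All-sublists Cxs)) ⟩
    sumBy (sublists xs) (λ s → sumBy (sublists ys) (λ t → if R₁ s then (if R₂ t then g (length s + length t) else 0) else 0))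
      ≡⟨ sumBy-cong (sublists xs) (λ s → sumBy-if (R₁ s) (sublists ys) _) ⟩
    sumBy (sublists xs) (λ s → if R₁ s then sumBy (sublists ys) (λ t → if R₂ t then g (length s + length t) else 0) else 0)
      ≡⟨ sumBy-cong (sublists xs) (λ s → cong (λ n → if R₁ s then n else 0) (sumBy-filter R₂ (sublists ys) (λ b → g (length s + b)))) ⟨
    sumBy (sublists xs) (λ s → if R₁ s then sumBy (gen R₂ ys) (λ b → g (length s + b)) else 0)
      ≡⟨ sumBy-filter R₁ (sublists xs) _ ⟨
    sumBy (gen R₁ xs) (λ a → sumBy (gen R₂ ys) (λ b → g (a + b)))
      ≡⟨ sumBy-⊗ (gen R₁ xs) (gen R₂ ys) g ⟨
    sumBy (gen R₁ xs ⊗ gen R₂ ys) g ∎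
    where
    if-∧ : ∀ a b n → (if a ∧ b then n else 0) ≡ (if a then (if b then n else 0) else 0)
    if-∧ true  b n = refl
    if-∧ false b n = refl

  gen-↭ : (R : List A → Bool) {xs ys : List A} → xs ↭ ys → (∀ {S S′} → S ↭ S′ → R S ≡ R S′) → gen R xs ≈ gen R ys
  gen-↭ R {xs} {ys} p R-↭ = mk≈ λ g → begin
    sumBy (gen R xs) g                                            ≡⟨ sumBy-filter R (sublists xs) g ⟩
    sumBy (sublists xs) (λ S → if R S then g (length S) else 0)
      ≡⟨ sumBy-sublists-↭ p _ (λ q → cong₂ (λ b n → if b then g n else 0) (R-↭ q) (↭P.↭-length q)) ⟩
    sumBy (sublists ys) (λ S → if R S then g (length S) else 0)   ≡⟨ sumBy-filter R (sublists ys) g ⟨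
    sumBy (gen R ys) g                                            ∎

sumBy-sublists-map : {A B : Set} (h : A → B) (xs : List A) (F : List B → ℕ) →
  sumBy (sublists (map h xs)) F ≡ sumBy (sublists xs) (F ∘ map h)
sumBy-sublists-map h []       F = refl
sumBy-sublists-map h (x ∷ xs) F = begin
  sumBy (sublists (h x ∷ map h xs)) F
    ≡⟨ sumBy-sublists-∷ (h x) (map h xs) F ⟩
  sumBy (sublists (map h xs)) (F ∘ (h x ∷_)) + sumBy (sublists (map h xs)) F
    ≡⟨ cong₂ _+_ (sumBy-sublists-map h xs _) (sumBy-sublists-map h xs F) ⟩
  sumBy (sublists xs) (F ∘ map h ∘ (x ∷_)) + sumBy (sublists xs) (F ∘ map h)
    ≡⟨ sumBy-sublists-∷ x xs (F ∘ map h) ⟨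
  sumBy (sublists (x ∷ xs)) (F ∘ map h) ∎
  where open ≡-Reasoning

gen-map : {A B : Set} (h : A → B) (R : List B → Bool) (xs : List A) → gen R (map h xs) ≈ gen (R ∘ map h) xs
gen-map h R xs = mk≈ λ g → begin
  sumBy (gen R (map h xs)) g                                             ≡⟨ sumBy-filter R (sublists (map h xs)) g ⟩
  sumBy (sublists (map h xs)) (λ S → if R S then g (length S) else 0)    ≡⟨ sumBy-sublists-map h xs _ ⟩
  sumBy (sublists xs) (λ S → if R (map h S) then g (length (map h S)) else 0)
    ≡⟨ sumBy-cong (sublists xs) (λ S → cong (λ n → if R (map h S) then g n else 0) (ListP.length-map h S)) ⟩
  sumBy (sublists xs) (λ S → if R (map h S) then g (length S) else 0)   ≡⟨ sumBy-filter (R ∘ map h) (sublists xs) g ⟨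
  sumBy (gen (R ∘ map h) xs) g                                           ∎
  where open ≡-Reasoning

≡ᵇ-refl : ∀ n → (n ≡ᵇ n) ≡ true
≡ᵇ-refl n = dec-true (n ℕP.≟ n) refl

≢⇒≡ᵇ-false : ∀ {m n} → m ≢ n → (m ≡ᵇ n) ≡ false
≢⇒≡ᵇ-false {m} {n} = dec-false (m ℕP.≟ n)

≡ᵇ-true⇒≡ : ∀ m n → (m ≡ᵇ n) ≡ true → m ≡ n
≡ᵇ-true⇒≡ m n eq = ℕP.≡ᵇ⇒≡ m n (subst T (sym eq) _)

module _ {A : Set} {x y : A} where

  if-≡ᵇ-refl : ∀ n → (if n ≡ᵇ n then x else y) ≡ x
  if-≡ᵇ-refl n rewrite ≡ᵇ-refl n = refl

  if-≡ᵇ-≢ : ∀ {m n} → m ≢ n → (if m ≡ᵇ n then x else y) ≡ y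
  if-≡ᵇ-≢ {m} {n} m≢n rewrite ≢⇒≡ᵇ-false m≢n = refl

Block : Set → Set
Block A = ℕ × List A

module _ {A : Set} where

  flatten : List (Block A) → List A
  flatten []             = []
  flatten ((c , B) ∷ bs) = B ++ flatten bs

  labels : List (Block A) → List ℕ
  labels = map proj₁

  ∏ : List (Block A) → (ℕ → List A → Poly) → Poly
  ∏ []             ψ = 𝟙
  ∏ ((c , B) ∷ bs) ψ = ψ c B ⊗ ∏ bs ψ

  ∏-cong : (bs : List (Block A)) {ψ ψ′ : ℕ → List A → Poly} → (∀ c B → ψ c B ≈ ψ′ c B) → ∏ bs ψ ≈ ∏ bs ψ′
  ∏-cong []             ψ≈ψ′ = ≈-refl
  ∏-cong ((c , B) ∷ bs) ψ≈ψ′ = ⊗-cong (ψ≈ψ′ c B) (∏-cong bs ψ≈ψ′)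

  _[_↦𝟙] : (ℕ → List A → Poly) → ℕ → ℕ → List A → Poly
  (ψ [ c ↦𝟙]) c′ B = if c′ ≡ᵇ c then 𝟙 else ψ c′ B

  ∏-cong-off : (bs : List (Block A)) {ψ ψ′ : ℕ → List A → Poly} {c₀ : ℕ} → c₀ ∉ labels bs →
    (∀ {c} B → c ≢ c₀ → ψ c B ≈ ψ′ c B) → ∏ bs ψ ≈ ∏ bs ψ′
  ∏-cong-off []             c₀∉ ψ≈ψ′ = ≈-refl
  ∏-cong-off ((c , B) ∷ bs) c₀∉ ψ≈ψ′ =
    ⊗-cong (ψ≈ψ′ B (λ { refl → c₀∉ (here refl) })) (∏-cong-off bs (c₀∉ ∘ there) ψ≈ψ′)

  ∏-extract : (bs : List (Block A)) (ψ : ℕ → List A → Poly) → Unique (labels bs) →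
    {c : ℕ} {B : List A} → (c , B) ∈ bs → ∏ bs ψ ≈ ψ c B ⊗ ∏ bs (ψ [ c ↦𝟙])
  ∏-extract ((c , B) ∷ bs) ψ (c∉ ∷ _) (here refl) rewrite if-≡ᵇ-refl {x = 𝟙} {ψ c B} c =
    ⊗-congˡ (ψ c B) (≈-sym (≈-trans (⊗-identityˡ _)
      (∏-cong-off bs (AllP.All¬⇒¬Any c∉) (λ _ c′≢c → ≈-reflexive (if-≡ᵇ-≢ c′≢c)))))
  ∏-extract ((c′ , B′) ∷ bs) ψ (c′∉ ∷ uniq) {c} {B} (there cB∈bs) =
    ≈-trans (⊗-congˡ (ψ c′ B′) (∏-extract bs ψ uniq cB∈bs))
   (≈-trans (solve 3 (λ a b p → a :* (b :* p) := b :* (a :* p)) ≈-refl (ψ c′ B′) (ψ c B) (∏ bs (ψ [ c ↦𝟙])))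
            (⊗-congˡ (ψ c B) (⊗-congʳ _ (≈-reflexive (sym (if-≡ᵇ-≢ c′≢c))))))
    where
    c′≢c : c′ ≢ c
    c′≢c refl = AllP.All¬⇒¬Any c′∉ (∈-map⁺ proj₁ cB∈bs)

  ∏-const : (bs : List (Block A)) (ψ : ℕ → List A → Poly) {p : Poly} →
    All (λ (c , B) → ψ c B ≈ p) bs → ∏ bs ψ ≈ p ^ length bs
  ∏-const []       ψ []         = ≈-refl
  ∏-const (_ ∷ bs) ψ (ψ≈p ∷ es) = ⊗-cong ψ≈p (∏-const bs ψ es)

  ∏-pointed : (bs : List (Block A)) (ψ : ℕ → List A → Poly) {p : Poly} {c₀ : ℕ} {B₀ : List A} →
    Unique (labels bs) → (c₀ , B₀) ∈ bs → All (λ (c , B) → c ≢ c₀ → ψ c B ≈ p) bs →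
    ∏ bs ψ ≈ ψ c₀ B₀ ⊗ p ^ pred (length bs)
  ∏-pointed ((c , B) ∷ bs) ψ (c∉ ∷ _) (here refl) (_ ∷ offs) =
    ⊗-congˡ (ψ c B) (∏-const bs ψ (All.zipWith (λ (c≢ , off) → off (c≢ ∘ sym)) (AllP.map⁻ c∉ , offs)))
  ∏-pointed ((c , B) ∷ b ∷ bs) ψ {p} {c₀} {B₀} (c∉ ∷ uniq) (there m) (off ∷ offs) =
    ≈-trans (⊗-cong (off c≢c₀) (∏-pointed (b ∷ bs) ψ uniq m offs))
            (solve 3 (λ a q r → q :* (a :* r) := a :* (q :* r)) ≈-refl (ψ c₀ B₀) p (p ^ length bs))
    where
    c≢c₀ : c ≢ c₀
    c≢c₀ refl = AllP.All¬⇒¬Any c∉ (∈-map⁺ proj₁ m)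

-- The blocks are the subtrees below a root or the components of a forest;
-- tag names the block of a vertex.
module Blocks {A : Set} (adj : A → A → Bool) (tag : A → ℕ) (Good : A → Set)
  (cross : ∀ {u w} → Good u → Good w → tag u ≢ tag w → adj u w ≡ false) (allowed : A → Bool) where

  Admissible : List A → Bool
  Admissible S = all allowed S ∧ isIndependent adj S

  AdmissibleAt : (A → Bool) → List A → Bool
  AdmissibleAt e S = any e S ∧ Admissible S

  Tagged : ℕ → A → Set
  Tagged c u = Good u × tag u ≡ c

  TaggedIn : List ℕ → A → Set
  TaggedIn L u = Good u × tag u ∈ L

  WellTagged : List (Block A) → Set
  WellTagged = All λ { (c , B) → All (Tagged c) B }

  flatten-taggedIn : (bs : List (Block A)) → WellTagged bs → All (TaggedIn (labels bs)) (flatten bs)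
  flatten-taggedIn []       []         = []
  flatten-taggedIn (b ∷ bs) (tb ∷ tbs) =
    AllP.++⁺ (All.map (λ (g , t) → g , here t) tb) (All.map (λ (g , t) → g , there t) (flatten-taggedIn bs tbs))

  Admissible-++ : {c : ℕ} {L : List ℕ} → c ∉ L → {s t : List A} → All (Tagged c) s → All (TaggedIn L) t →
    Admissible (s ++ t) ≡ Admissible s ∧ Admissible t
  Admissible-++ {c} {L} c∉L {s} {t} s-c t-L =
    trans (cong₂ _∧_ (all-++ allowed s t) (isIndependent-++ adj (Tagged c) (TaggedIn L) s-t t-s s-c t-L))
          (∧.interchange (all allowed s) (all allowed t) _ _)
    where
    s-t : ∀ {u w} → Tagged c u → TaggedIn L w → adj u w ≡ false
    s-t (gu , refl) (gw , tw∈L) = cross gu gw (λ tu≡tw → c∉L (subst (_∈ L) (sym tu≡tw) tw∈L))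
    t-s : ∀ {u w} → TaggedIn L u → Tagged c w → adj u w ≡ false
    t-s (gu , tu∈L) (gw , refl) = cross gu gw (λ tu≡tw → c∉L (subst (_∈ L) tu≡tw tu∈L))

  gen-flatten : (bs : List (Block A)) → WellTagged bs → Unique (labels bs) →
    gen Admissible (flatten bs) ≈ ∏ bs (λ _ → gen Admissible)
  gen-flatten []             []         []          = ≈-refl
  gen-flatten ((c , B) ∷ bs) (tB ∷ tbs) (c∉ ∷ uniq) =
    ≈-trans (gen-++ Admissible Admissible Admissible (Tagged c) (TaggedIn (labels bs)) tB (flatten-taggedIn bs tbs)
                    (Admissible-++ (AllP.All¬⇒¬Any c∉)))
            (⊗-congˡ (gen Admissible B) (gen-flatten bs tbs uniq))

  pointed : (A → Bool) → ℕ → ℕ → List A → Poly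
  pointed e c₀ c B = if c ≡ᵇ c₀ then gen (AdmissibleAt e) B else gen Admissible B

  module _ (e : A → Bool) (c₀ : ℕ) (e⇒tag : ∀ {u} → e u ≡ true → tag u ≡ c₀) where

    any-off : {D : A → Set} → (∀ {u} → D u → tag u ≢ c₀) → {xs : List A} → All D xs → any e xs ≡ false
    any-off D⇒≢ = any-false ∘ All.map (λ {u} Du → e-false (D⇒≢ Du))
      where
      e-false : ∀ {u} → tag u ≢ c₀ → e u ≡ false
      e-false {u} tu≢c₀ with e u in eu
      ... | false = refl
      ... | true  = ⊥-elim (tu≢c₀ (e⇒tag eu))

    gen-flatten-at : (bs : List (Block A)) → WellTagged bs → Unique (labels bs) → c₀ ∈ labels bs →
      gen (AdmissibleAt e) (flatten bs) ≈ ∏ bs (pointed e c₀)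
    gen-flatten-at ((c , B) ∷ bs) (tB ∷ tbs) (c∉ ∷ uniq) (here refl) =
      ≈-trans (gen-++ (AdmissibleAt e) (AdmissibleAt e) Admissible (Tagged c) (TaggedIn (labels bs)) tB tbs-L split)
              (⊗-cong (≈-reflexive (sym (if-≡ᵇ-refl c)))
                      (≈-trans (gen-flatten bs tbs uniq)
                               (∏-cong-off bs (AllP.All¬⇒¬Any c∉) (λ _ c′≢c → ≈-reflexive (sym (if-≡ᵇ-≢ c′≢c))))))
      where
      tbs-L = flatten-taggedIn bs tbs
      split : ∀ {s t} → All (Tagged c) s → All (TaggedIn (labels bs)) t →
        AdmissibleAt e (s ++ t) ≡ AdmissibleAt e s ∧ Admissible t
      split {s} {t} s-c t-L
        rewrite any-++ e s t | any-off (λ (_ , tu∈) tu≡c → AllP.All¬⇒¬Any c∉ (subst (_∈ labels bs) tu≡c tu∈)) t-L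
              | BoolP.∨-identityʳ (any e s) | Admissible-++ (AllP.All¬⇒¬Any c∉) s-c t-L =
        sym (BoolP.∧-assoc (any e s) _ _)
    gen-flatten-at ((c , B) ∷ bs) (tB ∷ tbs) (c∉ ∷ uniq) (there c₀∈) =
      ≈-trans (gen-++ (AdmissibleAt e) Admissible (AdmissibleAt e) (Tagged c) (TaggedIn (labels bs)) tB tbs-L split)
              (⊗-cong (≈-reflexive (sym (if-≡ᵇ-≢ c≢c₀))) (gen-flatten-at bs tbs uniq c₀∈))
      where
      tbs-L = flatten-taggedIn bs tbs
      c≢c₀ : c ≢ c₀
      c≢c₀ refl = AllP.All¬⇒¬Any c∉ c₀∈
      split : ∀ {s t} → All (Tagged c) s → All (TaggedIn (labels bs)) t →
        AdmissibleAt e (s ++ t) ≡ Admissible s ∧ AdmissibleAt e t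
      split {s} {t} s-c t-L
        rewrite any-++ e s t | any-off (λ (_ , tu≡c) → subst (_≢ c₀) (sym tu≡c) c≢c₀) s-c
              | Admissible-++ (AllP.All¬⇒¬Any c∉) s-c t-L =
        ∧.x∙yz≈y∙xz (any e t) (Admissible s) (Admissible t)

-- The perfect tree

module _ {A B : Set} where

  concatMap⁺ : (f : A → List B) {xs ys : List A} → xs ↭ ys → concatMap f xs ↭ concatMap f ys
  concatMap⁺ f ↭.refl         = ↭-refl
  concatMap⁺ f (↭.prep x p)   = ↭P.++⁺ˡ (f x) (concatMap⁺ f p)
  concatMap⁺ f (↭.swap x y p) = ↭-trans (↭P.shifts (f x) (f y)) (↭P.++⁺ˡ (f y) (↭P.++⁺ˡ (f x) (concatMap⁺ f p)))
  concatMap⁺ f (↭.trans p q)  = ↭-trans (concatMap⁺ f p) (concatMap⁺ f q)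

  concatMap-cong-↭ : {f g : A → List B} (xs : List A) → (∀ x → f x ↭ g x) → concatMap f xs ↭ concatMap g xs
  concatMap-cong-↭ []       f↭g = ↭-refl
  concatMap-cong-↭ (x ∷ xs) f↭g = ↭P.++⁺ (f↭g x) (concatMap-cong-↭ xs f↭g)

  concatMap-++-↭ : (f g : A → List B) (xs : List A) → concatMap (λ x → f x ++ g x) xs ↭ concatMap f xs ++ concatMap g xs
  concatMap-++-↭ f g []       = ↭-refl
  concatMap-++-↭ f g (x ∷ xs) = begin
    (f x ++ g x) ++ concatMap (λ x → f x ++ g x) xs  ≡⟨ ListP.++-assoc (f x) (g x) _ ⟩
    f x ++ g x ++ concatMap (λ x → f x ++ g x) xs    ↭⟨ ↭P.++⁺ˡ (f x) (↭P.++⁺ˡ (g x) (concatMap-++-↭ f g xs)) ⟩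
    f x ++ g x ++ concatMap f xs ++ concatMap g xs   ↭⟨ ↭P.++⁺ˡ (f x) (↭P.shifts (g x) (concatMap f xs)) ⟩
    f x ++ concatMap f xs ++ g x ++ concatMap g xs   ≡⟨ ListP.++-assoc (f x) (concatMap f xs) _ ⟨
    (f x ++ concatMap f xs) ++ g x ++ concatMap g xs ∎
    where open PermutationReasoning

concatMap-comm : {A B C : Set} (h : A → B → List C) (xs : List A) (ys : List B) →
  concatMap (λ y → concatMap (λ x → h x y) xs) ys ↭ concatMap (λ x → concatMap (h x) ys) xs
concatMap-comm h xs []       = ↭-reflexive (sym (MonadProperties.right-zero xs))
concatMap-comm h xs (y ∷ ys) =
  ↭-trans (↭P.++⁺ˡ (concatMap (λ x → h x y) xs) (concatMap-comm h xs ys))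
          (↭-sym (concatMap-++-↭ (λ x → h x y) (λ x → concatMap (h x) ys) xs))

eqL-≢ : ∀ {p q} → p ≢ q → eqL p q ≡ false
eqL-≢ {p} {q} = dec-false (ListP.≡-dec ℕP._≟_ p q)

eqL-true⇒≡ : ∀ p q → eqL p q ≡ true → p ≡ q
eqL-true⇒≡ p q eq with ListP.≡-dec ℕP._≟_ p q
... | yes p≡q = p≡q

eqL-∷ : ∀ c p q → eqL (c ∷ p) (c ∷ q) ≡ eqL p q
eqL-∷ c p q = does-⇔ (mk⇔ ListP.∷-injectiveʳ (cong (c ∷_))) (ListP.≡-dec ℕP._≟_ _ _) (ListP.≡-dec ℕP._≟_ p q)

pathAdj : List ℕ → List ℕ → Bool
pathAdj p q = parentᵇ p q ∨ parentᵇ q p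

parentᵇ-∷ : ∀ c p q → parentᵇ (c ∷ p) (c ∷ q) ≡ parentᵇ p q
parentᵇ-∷ c p q = cong ((length q ≡ᵇ suc (length p)) ∧_) (eqL-∷ c (take (length p) q) p)

pathAdj-∷ : ∀ c p q → pathAdj (c ∷ p) (c ∷ q) ≡ pathAdj p q
pathAdj-∷ c p q = cong₂ _∨_ (parentᵇ-∷ c p q) (parentᵇ-∷ c q p)

parentᵇ-head-≢ : ∀ {c d} p q → c ≢ d → parentᵇ (c ∷ p) (d ∷ q) ≡ false
parentᵇ-head-≢ {c} {d} p q c≢d =
  trans (cong ((length q ≡ᵇ suc (length p)) ∧_) (eqL-≢ {d ∷ take (length p) q} {c ∷ p} (c≢d ∘ sym ∘ ListP.∷-injectiveˡ)))
        (BoolP.∧-zeroʳ _)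

pathAdj-head-≢ : ∀ {c d} p q → c ≢ d → pathAdj (c ∷ p) (d ∷ q) ≡ false
pathAdj-head-≢ p q c≢d rewrite parentᵇ-head-≢ p q c≢d | parentᵇ-head-≢ q p (c≢d ∘ sym) = refl

pathAdj-root-∷ : ∀ c p → pathAdj [] (c ∷ p) ≡ eqL [] p
pathAdj-root-∷ c []      = refl
pathAdj-root-∷ c (x ∷ p) = refl

-- The perfect r-ary tree with t + 1 levels, listed root first and then subtree
-- by subtree, instead of level by level as by treeVertices.
perfectTree : ℕ → ℕ → List (List ℕ)
perfectTree r zero    = [ [] ]
perfectTree r (suc t) = [] ∷ flatten (map (λ c → c , map (c ∷_) (perfectTree r t)) (upTo r))

subtreeBlocks : ℕ → ℕ → List (Block (List ℕ))
subtreeBlocks r t = map (λ c → c , map (c ∷_) (perfectTree r t)) (upTo r)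

flatten-map : {A : Set} (B : ℕ → List A) (cs : List ℕ) → flatten (map (λ c → c , B c) cs) ≡ concatMap B cs
flatten-map B []       = refl
flatten-map B (c ∷ cs) = cong (B c ++_) (flatten-map B cs)

module _ (r : ℕ) where

  private
    extensions : List ℕ → List (List ℕ)
    extensions p = map (λ c → p ++ [ c ]) (upTo r)

  concatMap-extensions-∷ : ∀ c ps → concatMap extensions (map (c ∷_) ps) ≡ map (c ∷_) (concatMap extensions ps)
  concatMap-extensions-∷ c ps =
    trans (ListP.concatMap-map extensions (c ∷_) ps)
          (trans (ListP.concatMap-cong (λ p → ListP.map-∘ (upTo r)) ps) (sym (ListP.map-concatMap (c ∷_) extensions ps)))

  pathsOfLen-suc-↭ : ∀ d → pathsOfLen r (suc d) ↭ concatMap (λ c → map (c ∷_) (pathsOfLen r d)) (upTo r)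
  pathsOfLen-suc-↭ zero = ↭-reflexive (trans (ListP.++-identityʳ _)
    (sym (trans (sym (ListP.concatMap-map [_] [_] (upTo r))) (ListP.concatMap-pure (map [_] (upTo r))))))
  pathsOfLen-suc-↭ (suc d) = begin
    concatMap extensions (pathsOfLen r (suc d))
      ↭⟨ concatMap⁺ extensions (pathsOfLen-suc-↭ d) ⟩
    concatMap extensions (concatMap (λ c → map (c ∷_) (pathsOfLen r d)) (upTo r))
      ≡⟨ MonadProperties.associative (upTo r) (λ c → map (c ∷_) (pathsOfLen r d)) extensions ⟨
    concatMap (λ c → concatMap extensions (map (c ∷_) (pathsOfLen r d))) (upTo r)
      ≡⟨ ListP.concatMap-cong (λ c → concatMap-extensions-∷ c (pathsOfLen r d)) (upTo r) ⟩
    concatMap (λ c → map (c ∷_) (pathsOfLen r (suc d))) (upTo r) ∎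
    where open PermutationReasoning

  treeVertices-↭ : ∀ t → treeVertices r (suc t) ↭ perfectTree r t
  treeVertices-↭ zero    = ↭-refl
  treeVertices-↭ (suc t) = ↭.prep [] (begin
    concatMap (pathsOfLen r) (applyUpTo suc (suc t))
      ≡⟨ cong (concatMap (pathsOfLen r)) (ListP.map-upTo suc (suc t)) ⟨
    concatMap (pathsOfLen r) (map suc (upTo (suc t)))
      ≡⟨ ListP.concatMap-map (pathsOfLen r) suc (upTo (suc t)) ⟩
    concatMap (pathsOfLen r ∘ suc) (upTo (suc t))
      ↭⟨ concatMap-cong-↭ (upTo (suc t)) pathsOfLen-suc-↭ ⟩
    concatMap (λ d → concatMap (λ c → map (c ∷_) (pathsOfLen r d)) (upTo r)) (upTo (suc t))
      ↭⟨ concatMap-comm (λ c d → map (c ∷_) (pathsOfLen r d)) (upTo r) (upTo (suc t)) ⟩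
    concatMap (λ c → concatMap (map (c ∷_) ∘ pathsOfLen r) (upTo (suc t))) (upTo r)
      ≡⟨ ListP.concatMap-cong (λ c → ListP.map-concatMap (c ∷_) (pathsOfLen r) (upTo (suc t))) (upTo r) ⟨
    concatMap (λ c → map (c ∷_) (treeVertices r (suc t))) (upTo r)
      ↭⟨ concatMap-cong-↭ (upTo r) (λ c → ↭P.map⁺ (c ∷_) (treeVertices-↭ t)) ⟩
    concatMap (λ c → map (c ∷_) (perfectTree r t)) (upTo r)
      ≡⟨ flatten-map (λ c → map (c ∷_) (perfectTree r t)) (upTo r) ⟨
    flatten (subtreeBlocks r t) ∎)
    where open PermutationReasoning

hasRoot : List (List ℕ) → Bool
hasRoot = any (eqL [])

Ind Ind₀ Ind₁ : List (List ℕ) → Poly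
Ind  T = gen (isIndependent pathAdj) T
Ind₀ T = gen (λ S → not (hasRoot S) ∧ isIndependent pathAdj S) T
Ind₁ T = gen (λ S → hasRoot S ∧ isIndependent pathAdj S) T

IndAt IndAt₀ IndAt₁ : List ℕ → List (List ℕ) → Poly
IndAt  ℓ T = gen (λ S → any (eqL ℓ) S ∧ isIndependent pathAdj S) T
IndAt₀ ℓ T = gen (λ S → any (eqL ℓ) S ∧ (not (hasRoot S) ∧ isIndependent pathAdj S)) T
IndAt₁ ℓ T = gen (λ S → any (eqL ℓ) S ∧ (hasRoot S ∧ isIndependent pathAdj S)) T

Ind-split : ∀ T → Ind T ≈ Ind₀ T ⊕ Ind₁ T
Ind-split T = gen-split hasRoot (isIndependent pathAdj) T

IndAt-split : ∀ ℓ T → IndAt ℓ T ≈ IndAt₀ ℓ T ⊕ IndAt₁ ℓ T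
IndAt-split ℓ T =
  ≈-trans (gen-split hasRoot (λ S → any (eqL ℓ) S ∧ isIndependent pathAdj S) T)
          (⊕-cong (gen-cong T (λ S → ∧.x∙yz≈y∙xz (not (hasRoot S)) (any (eqL ℓ) S) (isIndependent pathAdj S)))
                  (gen-cong T (λ S → ∧.x∙yz≈y∙xz (hasRoot S) (any (eqL ℓ) S) (isIndependent pathAdj S))))

-- The subtree of the root containing a vertex (junk 0 for the root itself).
branch : List ℕ → ℕ
branch []      = 0
branch (c ∷ _) = c

NonRoot : List ℕ → Set
NonRoot p = p ≢ []

pathAdj-branch-≢ : ∀ {u w} → NonRoot u → NonRoot w → branch u ≢ branch w → pathAdj u w ≡ false
pathAdj-branch-≢ {[]}    u≢[] _    _   = ⊥-elim (u≢[] refl)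
pathAdj-branch-≢ {_ ∷ _} {[]} _ w≢[] _ = ⊥-elim (w≢[] refl)
pathAdj-branch-≢ {_ ∷ p} {_ ∷ q} _ _ c≢d = pathAdj-head-≢ p q c≢d

hasRoot-nonRoot : ∀ {S} → All NonRoot S → hasRoot S ≡ false
hasRoot-nonRoot = any-false ∘ All.map (λ u≢[] → eqL-≢ (u≢[] ∘ sym))

awayFromRoot : List ℕ → Bool
awayFromRoot p = not (pathAdj [] p)

isIndependent-root : ∀ S → isIndependent pathAdj ([] ∷ S) ≡ all awayFromRoot S ∧ isIndependent pathAdj S
isIndependent-root S = isIndependent-∷ pathAdj [] S refl (λ u → BoolP.∨-comm (parentᵇ u []) (parentᵇ [] u))

module _ (c : ℕ) (S : List (List ℕ)) where

  isIndependent-map-∷ : isIndependent pathAdj (map (c ∷_) S) ≡ isIndependent pathAdj S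
  isIndependent-map-∷ = isIndependent-map pathAdj pathAdj (c ∷_) (pathAdj-∷ c) S

  all-awayFromRoot-∷ : all awayFromRoot (map (c ∷_) S) ≡ not (hasRoot S)
  all-awayFromRoot-∷ =
    trans (all-map (c ∷_) awayFromRoot S) (trans (all-cong S (cong not ∘ pathAdj-root-∷ c)) (all-not (eqL []) S))

  any-eqL-∷ : ∀ ℓ → any (eqL (c ∷ ℓ)) (map (c ∷_) S) ≡ any (eqL ℓ) S
  any-eqL-∷ ℓ = trans (any-map (c ∷_) (eqL (c ∷ ℓ)) S) (any-cong S (eqL-∷ c ℓ))

module Subtrees = Blocks pathAdj branch NonRoot pathAdj-branch-≢ (λ _ → true)
module SubtreesAway = Blocks pathAdj branch NonRoot pathAdj-branch-≢ awayFromRoot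

Subtrees-Admissible : ∀ S → All NonRoot S → not (hasRoot S) ∧ isIndependent pathAdj S ≡ Subtrees.Admissible S
Subtrees-Admissible S nonRoot =
  trans (cong (λ a → not a ∧ isIndependent pathAdj S) (hasRoot-nonRoot nonRoot))
        (cong (_∧ isIndependent pathAdj S) (sym (all-const-true S)))

module _ (c : ℕ) (T : List (List ℕ)) where

  gen-subtree : gen Subtrees.Admissible (map (c ∷_) T) ≈ Ind T
  gen-subtree = ≈-trans (gen-map (c ∷_) _ T) (gen-cong T λ S →
    cong₂ _∧_ (all-const-true (map (c ∷_) S)) (isIndependent-map-∷ c S))

  gen-subtreeAway : gen SubtreesAway.Admissible (map (c ∷_) T) ≈ Ind₀ T
  gen-subtreeAway = ≈-trans (gen-map (c ∷_) _ T) (gen-cong T λ S →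
    cong₂ _∧_ (all-awayFromRoot-∷ c S) (isIndependent-map-∷ c S))

  gen-subtree-at : ∀ ℓ → gen (Subtrees.AdmissibleAt (eqL (c ∷ ℓ))) (map (c ∷_) T) ≈ IndAt ℓ T
  gen-subtree-at ℓ = ≈-trans (gen-map (c ∷_) _ T) (gen-cong T λ S →
    cong₂ _∧_ (any-eqL-∷ c S ℓ) (cong₂ _∧_ (all-const-true (map (c ∷_) S)) (isIndependent-map-∷ c S)))

  gen-subtreeAway-at : ∀ ℓ → gen (SubtreesAway.AdmissibleAt (eqL (c ∷ ℓ))) (map (c ∷_) T) ≈ IndAt₀ ℓ T
  gen-subtreeAway-at ℓ = ≈-trans (gen-map (c ∷_) _ T) (gen-cong T λ S →
    cong₂ _∧_ (any-eqL-∷ c S ℓ) (cong₂ _∧_ (all-awayFromRoot-∷ c S) (isIndependent-map-∷ c S)))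

module PerfectTreeRecurrences (r′ : ℕ) where

  open ≈-Reasoning

  r : ℕ
  r = suc r′

  private
    Tr : ℕ → List (List ℕ)
    Tr = perfectTree r

    blocks : ℕ → List (Block (List ℕ))
    blocks = subtreeBlocks r

    below : ℕ → List (List ℕ)
    below t = flatten (blocks t)

  all-blocks : ∀ {P : Block (List ℕ) → Set} t → (∀ c → P (c , map (c ∷_) (Tr t))) → All P (blocks t)
  all-blocks t P-block = AllP.map⁺ (All.universal P-block (upTo r))

  labels-blocks : ∀ t → labels (blocks t) ≡ upTo r
  labels-blocks t = trans (sym (ListP.map-∘ (upTo r))) (ListP.map-id (upTo r))

  length-blocks : ∀ t → length (blocks t) ≡ r
  length-blocks t = trans (ListP.length-map _ (upTo r)) (ListP.length-upTo r)

  unique-blocks : ∀ t → Unique (labels (blocks t))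
  unique-blocks t = subst Unique (sym (labels-blocks t)) (UniqueP.upTo⁺ r)

  wellTagged : ∀ t → Subtrees.WellTagged (blocks t)
  wellTagged t = all-blocks t λ c → AllP.map⁺ (All.universal (λ _ → (λ ()) , refl) (Tr t))

  block-∈ : ∀ {c} t → c < r → (c , map (c ∷_) (Tr t)) ∈ blocks t
  block-∈ t c<r = ∈-map⁺ (λ c → c , map (c ∷_) (Tr t)) (∈-upTo⁺ c<r)

  below-nonRoot : ∀ t → All NonRoot (below t)
  below-nonRoot t = All.map proj₁ (Subtrees.flatten-taggedIn (blocks t) (wellTagged t))

  ∏-blocks-const : ∀ t (ψ : ℕ → List (List ℕ) → Poly) {p : Poly} →
    (∀ c → ψ c (map (c ∷_) (Tr t)) ≈ p) → ∏ (blocks t) ψ ≈ p ^ r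
  ∏-blocks-const t ψ {p} ψ≈p =
    ≈-trans (∏-const (blocks t) ψ (all-blocks t ψ≈p)) (≈-reflexive (cong (p ^_) (length-blocks t)))

  ∏-blocks-pointed : ∀ t (ψ : ℕ → List (List ℕ) → Poly) {a p : Poly} {c} → c < r →
    ψ c (map (c ∷_) (Tr t)) ≈ a → (∀ d → d ≢ c → ψ d (map (d ∷_) (Tr t)) ≈ p) → ∏ (blocks t) ψ ≈ a ⊗ p ^ r′
  ∏-blocks-pointed t ψ {a} {p} c<r ψ≈a ψ≈p =
    ≈-trans (∏-pointed (blocks t) ψ (unique-blocks t) (block-∈ t c<r) (all-blocks t ψ≈p))
            (⊗-cong ψ≈a (≈-reflexive (cong (λ n → p ^ pred n) (length-blocks t))))

  eqL-branch : ∀ c ℓ u → eqL (c ∷ ℓ) u ≡ true → branch u ≡ c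
  eqL-branch c ℓ u eq = cong branch (sym (eqL-true⇒≡ (c ∷ ℓ) u eq))

  Ind₀-step : ∀ t → Ind₀ (Tr (suc t)) ≈ Ind (Tr t) ^ r
  Ind₀-step t = begin
    Ind₀ (Tr (suc t))
      ≈⟨ gen-∷-excluded (λ S → not (hasRoot S) ∧ isIndependent pathAdj S) [] (below t) (λ S → refl) ⟩
    gen (λ S → not (hasRoot S) ∧ isIndependent pathAdj S) (below t)
      ≈⟨ gen-congᶜ NonRoot (below-nonRoot t) Subtrees-Admissible ⟩
    gen Subtrees.Admissible (below t)
      ≈⟨ Subtrees.gen-flatten (blocks t) (wellTagged t) (unique-blocks t) ⟩
    ∏ (blocks t) (λ _ → gen Subtrees.Admissible)
      ≈⟨ ∏-blocks-const t (λ _ → gen Subtrees.Admissible) (λ c → gen-subtree c (Tr t)) ⟩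
    Ind (Tr t) ^ r ∎

  Ind₁-step : ∀ t → Ind₁ (Tr (suc t)) ≈ X ⊗ Ind₀ (Tr t) ^ r
  Ind₁-step t = begin
    Ind₁ (Tr (suc t))
      ≈⟨ gen-∷-forced (λ S → hasRoot S ∧ isIndependent pathAdj S) [] NonRoot (below-nonRoot t)
           (λ S nr → cong (_∧ isIndependent pathAdj S) (hasRoot-nonRoot nr)) ⟩
    X ⊗ gen (λ S → isIndependent pathAdj ([] ∷ S)) (below t)
      ≈⟨ ⊗-congˡ X (gen-cong (below t) isIndependent-root) ⟩
    X ⊗ gen SubtreesAway.Admissible (below t)
      ≈⟨ ⊗-congˡ X (SubtreesAway.gen-flatten (blocks t) (wellTagged t) (unique-blocks t)) ⟩
    X ⊗ ∏ (blocks t) (λ _ → gen SubtreesAway.Admissible)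
      ≈⟨ ⊗-congˡ X (∏-blocks-const t (λ _ → gen SubtreesAway.Admissible) (λ c → gen-subtreeAway c (Tr t))) ⟩
    X ⊗ Ind₀ (Tr t) ^ r ∎

  module _ (t : ℕ) {c : ℕ} (ℓ : List ℕ) (c<r : c < r) where

    private
      e : List ℕ → Bool
      e = eqL (c ∷ ℓ)
      c∈labels : c ∈ labels (blocks t)
      c∈labels = ∈-map⁺ proj₁ (block-∈ t c<r)

    IndAt₀-step : IndAt₀ (c ∷ ℓ) (Tr (suc t)) ≈ IndAt ℓ (Tr t) ⊗ Ind (Tr t) ^ r′
    IndAt₀-step = begin
      IndAt₀ (c ∷ ℓ) (Tr (suc t))
        ≈⟨ gen-∷-excluded (λ S → any e S ∧ (not (hasRoot S) ∧ isIndependent pathAdj S)) [] (below t)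
             (λ S → BoolP.∧-zeroʳ (any e ([] ∷ S))) ⟩
      gen (λ S → any e S ∧ (not (hasRoot S) ∧ isIndependent pathAdj S)) (below t)
        ≈⟨ gen-congᶜ NonRoot (below-nonRoot t) (λ S → cong (any e S ∧_) ∘ Subtrees-Admissible S) ⟩
      gen (Subtrees.AdmissibleAt e) (below t)
        ≈⟨ Subtrees.gen-flatten-at e c (λ {u} → eqL-branch c ℓ u) (blocks t) (wellTagged t) (unique-blocks t) c∈labels ⟩
      ∏ (blocks t) (Subtrees.pointed e c)
        ≈⟨ ∏-blocks-pointed t (Subtrees.pointed e c) c<r (≈-trans (≈-reflexive (if-≡ᵇ-refl c)) (gen-subtree-at c (Tr t) ℓ))
                                     (λ d d≢c → ≈-trans (≈-reflexive (if-≡ᵇ-≢ d≢c)) (gen-subtree d (Tr t))) ⟩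
      IndAt ℓ (Tr t) ⊗ Ind (Tr t) ^ r′ ∎

    IndAt₁-step : IndAt₁ (c ∷ ℓ) (Tr (suc t)) ≈ X ⊗ (IndAt₀ ℓ (Tr t) ⊗ Ind₀ (Tr t) ^ r′)
    IndAt₁-step = begin
      IndAt₁ (c ∷ ℓ) (Tr (suc t))
        ≈⟨ gen-∷-forced (λ S → any e S ∧ (hasRoot S ∧ isIndependent pathAdj S)) [] NonRoot (below-nonRoot t) (λ S nr →
             trans (cong (λ h → any e S ∧ (h ∧ isIndependent pathAdj S)) (hasRoot-nonRoot nr)) (BoolP.∧-zeroʳ (any e S))) ⟩
      X ⊗ gen (λ S → any e S ∧ isIndependent pathAdj ([] ∷ S)) (below t)
        ≈⟨ ⊗-congˡ X (gen-cong (below t) (λ S → cong (any e S ∧_) (isIndependent-root S))) ⟩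
      X ⊗ gen (SubtreesAway.AdmissibleAt e) (below t)
        ≈⟨ ⊗-congˡ X (SubtreesAway.gen-flatten-at e c (λ {u} → eqL-branch c ℓ u) (blocks t) (wellTagged t) (unique-blocks t) c∈labels) ⟩
      X ⊗ ∏ (blocks t) (SubtreesAway.pointed e c)
        ≈⟨ ⊗-congˡ X (∏-blocks-pointed t (SubtreesAway.pointed e c) c<r (≈-trans (≈-reflexive (if-≡ᵇ-refl c)) (gen-subtreeAway-at c (Tr t) ℓ))
                                                (λ d d≢c → ≈-trans (≈-reflexive (if-≡ᵇ-≢ d≢c)) (gen-subtreeAway d (Tr t)))) ⟩
      X ⊗ (IndAt₀ ℓ (Tr t) ⊗ Ind₀ (Tr t) ^ r′) ∎

-- The recurrences and their comparison

even? : ℕ → Bool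
even? zero    = true
even? (suc n) = not (even? n)

-- P, Q, R count the independent sets of the perfect (r′ + 1)-ary tree with
-- t + 1 levels (all of them, those avoiding the root, those using it), and
-- L, K, J those containing a fixed leaf.
module Recurrence (r′ : ℕ) where

  mutual
    P : ℕ → Poly
    P t = Q t ⊕ R t

    Q : ℕ → Poly
    Q zero    = 𝟙
    Q (suc t) = P t ^ suc r′

    R : ℕ → Poly
    R zero    = X
    R (suc t) = X ⊗ Q t ^ suc r′

  mutual
    L : ℕ → Poly
    L t = K t ⊕ J t

    K : ℕ → Poly
    K zero    = 𝟘
    K (suc t) = L t ⊗ P t ^ r′

    J : ℕ → Poly
    J zero    = X
    J (suc t) = X ⊗ (K t ⊗ Q t ^ r′)

  module _ (γ : Poly) (t : ℕ) where

    ⊗-Q-suc : γ ⊗ Q (suc t) ≈ (γ ⊗ Q t ⊕ γ ⊗ R t) ⊗ P t ^ r′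
    ⊗-Q-suc = solve 4 (λ γ q r p → γ :* ((q :+ r) :* p) := (γ :* q :+ γ :* r) :* p) ≈-refl γ (Q t) (R t) (P t ^ r′)

    ⊗-K-suc : γ ⊗ K (suc t) ≈ (γ ⊗ K t ⊕ γ ⊗ J t) ⊗ P t ^ r′
    ⊗-K-suc = solve 4 (λ γ k j p → γ :* ((k :+ j) :* p) := (γ :* k :+ γ :* j) :* p) ≈-refl γ (K t) (J t) (P t ^ r′)

    ⊗-R-suc : γ ⊗ R (suc t) ≈ X ⊗ (γ ⊗ Q t) ⊗ Q t ^ r′
    ⊗-R-suc = solve 4 (λ γ x q s → γ :* (x :* (q :* s)) := x :* (γ :* q) :* s) ≈-refl γ X (Q t) (Q t ^ r′)

    ⊗-J-suc : γ ⊗ J (suc t) ≈ X ⊗ (γ ⊗ K t) ⊗ Q t ^ r′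
    ⊗-J-suc = solve 4 (λ γ x k s → γ :* (x :* (k :* s)) := x :* (γ :* k) :* s) ≈-refl γ X (K t) (Q t ^ r′)

  RK≲JQ : ∀ t → R t ⊗ K t ≲[ even? t ] J t ⊗ Q t
  RK≲JQ zero    = ≲-resp-≈ (≈-sym (⊗-zeroʳ X)) ≈-refl (𝟘-≲ (J zero ⊗ Q zero))
  RK≲JQ (suc t) = ≲[]-resp-≈ (not (even? t)) (≈-sym RK) (≈-sym JQ)
    (⊗-monoʳ-≲[] _ C (⊕-mono-≲[] _ (≲[]-reflexive _ (⊗-comm (Q t) (K t))) (≲[]-flip (even? t) (RK≲JQ t))))
    where
    C : Poly
    C = X ⊗ Q t ^ r′ ⊗ P t ^ r′
    RK : R (suc t) ⊗ K (suc t) ≈ C ⊗ (Q t ⊗ K t ⊕ J t ⊗ Q t)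
    RK = solve 6 (λ x q s k j p → x :* (q :* s) :* ((k :+ j) :* p) := x :* s :* p :* (q :* k :+ j :* q))
                 ≈-refl X (Q t) (Q t ^ r′) (K t) (J t) (P t ^ r′)
    JQ : J (suc t) ⊗ Q (suc t) ≈ C ⊗ (K t ⊗ Q t ⊕ R t ⊗ K t)
    JQ = solve 6 (λ x k s q r p → x :* (k :* s) :* ((q :+ r) :* p) := x :* s :* p :* (k :* q :+ r :* k))
                 ≈-refl X (K t) (Q t ^ r′) (Q t) (R t) (P t ^ r′)

  Dominates : Bool → ℕ → ℕ → Set
  Dominates b m n = (P m ⊗ K n ≲[ b ] L m ⊗ Q n) × (P m ⊗ J n ≲[ b ] L m ⊗ R n)

  dominates-base : ∀ m → Dominates (even? m) m (suc m)
  dominates-base m = ≲[]-reflexive (even? m) PK≈LQ ,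
    ≲[]-resp-≈ (even? m) (≈-sym PJ) (≈-sym LR)
      (⊗-monoʳ-≲[] (even? m) (X ⊗ Q m ^ r′) (⊕-mono-≲[] (even? m) (≲[]-reflexive (even? m) ≈-refl) (RK≲JQ m)))
    where
    PK≈LQ : P m ⊗ K (suc m) ≈ L m ⊗ Q (suc m)
    PK≈LQ = solve 3 (λ p l s → p :* (l :* s) := l :* (p :* s)) ≈-refl (P m) (L m) (P m ^ r′)
    PJ : P m ⊗ J (suc m) ≈ X ⊗ Q m ^ r′ ⊗ (K m ⊗ Q m ⊕ R m ⊗ K m)
    PJ = solve 5 (λ q r x k s → (q :+ r) :* (x :* (k :* s)) := x :* s :* (k :* q :+ r :* k)) ≈-refl (Q m) (R m) X (K m) (Q m ^ r′)
    LR : L m ⊗ R (suc m) ≈ X ⊗ Q m ^ r′ ⊗ (K m ⊗ Q m ⊕ J m ⊗ Q m)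
    LR = solve 5 (λ k j x q s → (k :+ j) :* (x :* (q :* s)) := x :* s :* (k :* q :+ j :* q)) ≈-refl (K m) (J m) X (Q m) (Q m ^ r′)

  dominates-suc : ∀ b m n → Dominates b m n → Dominates b m (suc n)
  dominates-suc b m n (PK≲LQ , PJ≲LR) =
    ≲[]-resp-≈ b (≈-sym (⊗-K-suc (P m) n)) (≈-sym (⊗-Q-suc (L m) n)) (⊗-monoˡ-≲[] b (P n ^ r′) (⊕-mono-≲[] b PK≲LQ PJ≲LR)) ,
    ≲[]-resp-≈ b (≈-sym (⊗-J-suc (P m) n)) (≈-sym (⊗-R-suc (L m) n)) (⊗-monoˡ-≲[] b (Q n ^ r′) (⊗-monoʳ-≲[] b X PK≲LQ))

  dominates : ∀ m n → m < n → Dominates (even? m) m n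
  dominates m (suc n) m<1+n with ℕP.m<1+n⇒m<n∨m≡n m<1+n
  ... | inj₁ m<n  = dominates-suc (even? m) m n (dominates m n m<n)
  ... | inj₂ refl = dominates-base m

  PL≲LP : ∀ {m n} → m < n → P m ⊗ L n ≲[ even? m ] L m ⊗ P n
  PL≲LP {m} {n} m<n = ≲[]-resp-≈ (even? m) (≈-sym (⊗-distribˡ-⊕ (P m) (K n) (J n))) (≈-sym (⊗-distribˡ-⊕ (L m) (Q n) (R n)))
    (⊕-mono-≲[] (even? m) (proj₁ (dominates m n m<n)) (proj₂ (dominates m n m<n)))

module _ (r′ : ℕ) where
  open Recurrence r′
  open PerfectTreeRecurrences r′

  Ind₀-Ind₁-≈ : ∀ t → Ind₀ (perfectTree r t) ≈ Q t × Ind₁ (perfectTree r t) ≈ R t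
  Ind₀-Ind₁-≈ zero    = ≈-refl , ≈-refl
  Ind₀-Ind₁-≈ (suc t) =
    ≈-trans (Ind₀-step t) (^-cong r (≈-trans (Ind-split (perfectTree r t)) (⊕-cong Ind₀≈Q Ind₁≈R))) ,
    ≈-trans (Ind₁-step t) (⊗-congˡ X (^-cong r Ind₀≈Q))
    where
    Ind₀≈Q = proj₁ (Ind₀-Ind₁-≈ t)
    Ind₁≈R = proj₂ (Ind₀-Ind₁-≈ t)

  Ind-≈ : ∀ t → Ind (perfectTree r t) ≈ P t
  Ind-≈ t = ≈-trans (Ind-split (perfectTree r t)) (⊕-cong (proj₁ (Ind₀-Ind₁-≈ t)) (proj₂ (Ind₀-Ind₁-≈ t)))

  IndAt₀-IndAt₁-≈ : ∀ {ℓ} t → length ℓ ≡ t → All (_< r) ℓ →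
    IndAt₀ ℓ (perfectTree r t) ≈ K t × IndAt₁ ℓ (perfectTree r t) ≈ J t
  IndAt₀-IndAt₁-≈ {[]}    zero    refl []          = ≈-refl , ≈-refl
  IndAt₀-IndAt₁-≈ {c ∷ ℓ} (suc t) eq   (c<r ∷ ℓ<r) =
    ≈-trans (IndAt₀-step t ℓ c<r) (⊗-cong (≈-trans (IndAt-split ℓ (perfectTree r t)) (⊕-cong IndAt₀≈K IndAt₁≈J)) (^-cong r′ (Ind-≈ t))) ,
    ≈-trans (IndAt₁-step t ℓ c<r) (⊗-congˡ X (⊗-cong IndAt₀≈K (^-cong r′ (proj₁ (Ind₀-Ind₁-≈ t)))))
    where
    IH = IndAt₀-IndAt₁-≈ t (ℕP.suc-injective eq) ℓ<r
    IndAt₀≈K = proj₁ IH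
    IndAt₁≈J = proj₂ IH

  IndAt-≈ : ∀ {ℓ} t → length ℓ ≡ t → All (_< r) ℓ → IndAt ℓ (perfectTree r t) ≈ L t
  IndAt-≈ {ℓ} t len ℓ<r =
    ≈-trans (IndAt-split ℓ (perfectTree r t)) (⊕-cong (proj₁ (IndAt₀-IndAt₁-≈ t len ℓ<r)) (proj₂ (IndAt₀-IndAt₁-≈ t len ℓ<r)))

Ind-treeVertices : ∀ r t → Ind (treeVertices r (suc t)) ≈ Ind (perfectTree r t)
Ind-treeVertices r t = gen-↭ _ (treeVertices-↭ r t) (isIndependent-↭ pathAdj)

IndAt-treeVertices : ∀ r t ℓ → IndAt ℓ (treeVertices r (suc t)) ≈ IndAt ℓ (perfectTree r t)
IndAt-treeVertices r t ℓ = gen-↭ _ (treeVertices-↭ r t) (λ p → cong₂ _∧_ (any-↭ (eqL ℓ) p) (isIndependent-↭ pathAdj p))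

%2≡if-even? : ∀ n → n % 2 ≡ (if even? n then 0 else 1)
%2≡if-even? zero          = refl
%2≡if-even? (suc zero)    = refl
%2≡if-even? (suc (suc n)) = begin
  (2 + n) % 2                        ≡⟨ cong (_% 2) (ℕP.+-comm 2 n) ⟩
  (n + 2) % 2                        ≡⟨ [m+n]%n≡m%n n 2 ⟩
  n % 2                              ≡⟨ %2≡if-even? n ⟩
  (if even? n then 0 else 1)         ≡⟨ cong (λ b → if b then 0 else 1) (BoolP.not-involutive (even? n)) ⟨
  (if even? (suc (suc n)) then 0 else 1) ∎
  where open ≡-Reasoning

even?-of-suc-%2 : ∀ m b → suc m % 2 ≡ (if b then 1 else 0) → even? m ≡ b
even?-of-suc-%2 m b eq with even? m | b | trans (sym eq) (%2≡if-even? (suc m))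
... | true  | true  | _  = refl
... | false | false | _  = refl
... | true  | false | ()
... | false | true  | ()

perfectTree-comparison : ∀ {r h₁ h₂ ℓ₁ ℓ₂} → h₁ < h₂ → IsLeaf r h₁ ℓ₁ → IsLeaf r h₂ ℓ₂ →
  (h₁ % 2 ≡ 0 → IndAt ℓ₁ (treeVertices r h₁) ⊗ Ind (treeVertices r h₂) ≲ Ind (treeVertices r h₁) ⊗ IndAt ℓ₂ (treeVertices r h₂)) ×
  (h₁ % 2 ≡ 1 → IndAt ℓ₂ (treeVertices r h₂) ⊗ Ind (treeVertices r h₁) ≲ Ind (treeVertices r h₂) ⊗ IndAt ℓ₁ (treeVertices r h₁))
perfectTree-comparison {h₁ = zero} {ℓ₁ = []} _ _ _ = (λ _ → 𝟘-≲ _) , λ ()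
-- In arity 0 no leaf lies below the root.
perfectTree-comparison {zero} {suc m} {suc zero} (s≤s ()) _ _
perfectTree-comparison {zero} {suc m} {suc (suc n)} {ℓ₂ = []}    _ _ (() , _)
perfectTree-comparison {zero} {suc m} {suc (suc n)} {ℓ₂ = _ ∷ _} _ _ (_ , () ∷ _)
perfectTree-comparison {suc r′} {suc m} {suc n} {ℓ₁} {ℓ₂} (s≤s m<n) (len₁ , ℓ₁<r) (len₂ , ℓ₂<r) = even , odd
  where
  open Recurrence r′
  Pₘ : Ind (treeVertices (suc r′) (suc m)) ≈ P m
  Pₘ = ≈-trans (Ind-treeVertices _ m) (Ind-≈ r′ m)
  Pₙ : Ind (treeVertices (suc r′) (suc n)) ≈ P n
  Pₙ = ≈-trans (Ind-treeVertices _ n) (Ind-≈ r′ n)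
  Lₘ : IndAt ℓ₁ (treeVertices (suc r′) (suc m)) ≈ L m
  Lₘ = ≈-trans (IndAt-treeVertices _ m ℓ₁) (IndAt-≈ r′ m len₁ ℓ₁<r)
  Lₙ : IndAt ℓ₂ (treeVertices (suc r′) (suc n)) ≈ L n
  Lₙ = ≈-trans (IndAt-treeVertices _ n ℓ₂) (IndAt-≈ r′ n len₂ ℓ₂<r)
  even : suc m % 2 ≡ 0 → _
  even h₁-even = ≲-resp-≈ (≈-sym (⊗-cong Lₘ Pₙ)) (≈-sym (⊗-cong Pₘ Lₙ))
    (subst (λ b → P m ⊗ L n ≲[ b ] L m ⊗ P n) (even?-of-suc-%2 m false h₁-even) (PL≲LP m<n))
  odd : suc m % 2 ≡ 1 → _
  odd h₁-odd = ≲-resp-≈ (≈-sym (⊗-cong Lₙ Pₘ)) (≈-sym (⊗-cong Pₙ Lₘ))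
    (≲-resp-≈ (⊗-comm (P m) (L n)) (⊗-comm (L m) (P n))
      (subst (λ b → P m ⊗ L n ≲[ b ] L m ⊗ P n) (even?-of-suc-%2 m true h₁-odd) (PL≲LP m<n)))

-- Forests

length-filterᵇ : {A : Set} (Q : A → Bool) (xs : List A) → length (filterᵇ Q xs) ≡ sumBy xs (λ x → if Q x then 1 else 0)
length-filterᵇ Q []       = refl
length-filterᵇ Q (x ∷ xs) with Q x
... | true  = cong suc (length-filterᵇ Q xs)
... | false = length-filterᵇ Q xs

length-filter-size : {A : Set} (k : ℕ) (R : List A → Bool) (Ss : List (List A)) →
  length (filterᵇ (λ S → (length S ≡ᵇ k) ∧ R S) Ss) ≡ coeff k (map length (filterᵇ R Ss))
length-filter-size k R Ss =
  trans (length-filterᵇ _ Ss) (trans (sumBy-cong Ss (λ S → if-∧ (length S ≡ᵇ k) (R S))) (sym (sumBy-filter R Ss _)))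
  where
  if-∧ : ∀ a b → (if a ∧ b then 1 else 0) ≡ (if b then (if a then 1 else 0) else 0)
  if-∧ true  true  = refl
  if-∧ true  false = refl
  if-∧ false true  = refl
  if-∧ false false = refl

adj-differ : ∀ {u w} → ⊤ → ⊤ → proj₁ u ≢ proj₁ w → adj u w ≡ false
adj-differ {i , _} {j , _} _ _ i≢j rewrite ≢⇒≡ᵇ-false i≢j = refl

module Components = Blocks adj proj₁ (λ _ → ⊤) (λ {u} {w} → adj-differ {u} {w}) (λ _ → true)

componentBlocks : ℕ → Forest → List (Block Vertex)
componentBlocks o []            = []
componentBlocks o ((r , h) ∷ F) = (o , map (o ,_) (treeVertices r h)) ∷ componentBlocks (suc o) F

flatten-componentBlocks : ∀ o F → flatten (componentBlocks o F) ≡ verticesFrom o F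
flatten-componentBlocks o []            = refl
flatten-componentBlocks o ((r , h) ∷ F) = cong (map (o ,_) (treeVertices r h) ++_) (flatten-componentBlocks (suc o) F)

labels-componentBlocks-≥ : ∀ o F → All (o ≤_) (labels (componentBlocks o F))
labels-componentBlocks-≥ o []      = []
labels-componentBlocks-≥ o (_ ∷ F) = ℕP.≤-refl ∷ All.map (ℕP.≤-trans (ℕP.n≤1+n o)) (labels-componentBlocks-≥ (suc o) F)

unique-componentBlocks : ∀ o F → Unique (labels (componentBlocks o F))
unique-componentBlocks o []      = []
unique-componentBlocks o (_ ∷ F) =
  All.map (λ o<c o≡c → ℕP.<-irrefl o≡c o<c) (labels-componentBlocks-≥ (suc o) F) ∷ unique-componentBlocks (suc o) F

wellTagged-componentBlocks : ∀ o F → Components.WellTagged (componentBlocks o F)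
wellTagged-componentBlocks o []            = []
wellTagged-componentBlocks o ((r , h) ∷ F) =
  AllP.map⁺ (All.universal (λ _ → tt , refl) (treeVertices r h)) ∷ wellTagged-componentBlocks (suc o) F

componentBlock-∈ : ∀ o F (i : Fin (length F)) {r h} → lookup F i ≡ (r , h) →
  (o + toℕ i , map (o + toℕ i ,_) (treeVertices r h)) ∈ componentBlocks o F
componentBlock-∈ o (_ ∷ F) Fin.zero    refl rewrite ℕP.+-identityʳ o = here refl
componentBlock-∈ o (_ ∷ F) (Fin.suc i) eq   rewrite ℕP.+-suc o (toℕ i) = there (componentBlock-∈ (suc o) F i eq)

module _ (o : ℕ) (T : List (List ℕ)) where

  adj-same : ∀ p q → adj (o , p) (o , q) ≡ pathAdj p q
  adj-same p q rewrite ≡ᵇ-refl o = refl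

  eqV-same : ∀ ℓ p → eqV (o , ℓ) (o , p) ≡ eqL ℓ p
  eqV-same ℓ p rewrite ≡ᵇ-refl o = refl

  isIndependent-component : ∀ S → isIndependent adj (map (o ,_) S) ≡ isIndependent pathAdj S
  isIndependent-component = isIndependent-map adj pathAdj (o ,_) adj-same

  gen-component : gen Components.Admissible (map (o ,_) T) ≈ Ind T
  gen-component = ≈-trans (gen-map (o ,_) _ T) (gen-cong T λ S →
    cong₂ _∧_ (all-const-true (map (o ,_) S)) (isIndependent-component S))

  gen-component-at : ∀ ℓ → gen (Components.AdmissibleAt (eqV (o , ℓ))) (map (o ,_) T) ≈ IndAt ℓ T
  gen-component-at ℓ = ≈-trans (gen-map (o ,_) _ T) (gen-cong T λ S →
    cong₂ _∧_ (trans (any-map (o ,_) _ S) (any-cong S (eqV-same ℓ)))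
              (cong₂ _∧_ (all-const-true (map (o ,_) S)) (isIndependent-component S)))

Others : Forest → ℕ → ℕ → Poly
Others F I J = ∏ (componentBlocks 0 F) (((λ _ → gen Components.Admissible) [ I ↦𝟙]) [ J ↦𝟙])

Others-comm : ∀ F I J → Others F I J ≈ Others F J I
Others-comm F I J = ∏-cong (componentBlocks 0 F) swap
  where
  swap : ∀ c B → (((λ _ → gen Components.Admissible) [ I ↦𝟙]) [ J ↦𝟙]) c B ≈ (((λ _ → gen Components.Admissible) [ J ↦𝟙]) [ I ↦𝟙]) c B
  swap c B with c ≡ᵇ I | c ≡ᵇ J
  ... | true  | true  = ≈-refl
  ... | true  | false = ≈-refl
  ... | false | true  = ≈-refl
  ... | false | false = ≈-refl

eqV-true⇒ : ∀ v u → eqV v u ≡ true → proj₁ u ≡ proj₁ v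
eqV-true⇒ (a , p) (b , q) eq with a ≡ᵇ b in a≡b
... | true = sym (≡ᵇ-true⇒≡ a b a≡b)

numIndep-∏ : ∀ F k v → proj₁ v ∈ labels (componentBlocks 0 F) →
  numIndep F k v ≡ coeff k (∏ (componentBlocks 0 F) (Components.pointed (eqV v) (proj₁ v)))
numIndep-∏ F k v v∈ = trans (length-filter-size k _ (sublists (vertices F))) (coeff-cong k (begin
  gen (λ S → any (eqV v) S ∧ independent S) (vertices F)
    ≈⟨ gen-cong (vertices F) (λ S → cong (λ a → any (eqV v) S ∧ (a ∧ independent S)) (sym (all-const-true S))) ⟩
  gen (Components.AdmissibleAt (eqV v)) (vertices F)
    ≡⟨ cong (gen (Components.AdmissibleAt (eqV v))) (flatten-componentBlocks 0 F) ⟨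
  gen (Components.AdmissibleAt (eqV v)) (flatten (componentBlocks 0 F))
    ≈⟨ Components.gen-flatten-at (eqV v) (proj₁ v) (λ {u} → eqV-true⇒ v u) (componentBlocks 0 F)
         (wellTagged-componentBlocks 0 F) (unique-componentBlocks 0 F) v∈ ⟩
  ∏ (componentBlocks 0 F) (Components.pointed (eqV v) (proj₁ v)) ∎))
  where open ≈-Reasoning

∏-components-factor : ∀ F (i j : Fin (length F)) → toℕ i ≢ toℕ j → ∀ {r h r′ h′} →
  lookup F i ≡ (r , h) → lookup F j ≡ (r′ , h′) → ∀ ℓ →
  ∏ (componentBlocks 0 F) (Components.pointed (eqV (toℕ i , ℓ)) (toℕ i))
    ≈ IndAt ℓ (treeVertices r h) ⊗ (Ind (treeVertices r′ h′) ⊗ Others F (toℕ i) (toℕ j))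
∏-components-factor F i j i≢j {r} {h} {r′} {h′} Fi Fj ℓ = begin
  ∏ bs ψ
    ≈⟨ ∏-extract bs ψ uniq Bᵢ∈ ⟩
  ψ I Bᵢ ⊗ ∏ bs (ψ [ I ↦𝟙])
    ≈⟨ ⊗-congˡ (ψ I Bᵢ) (∏-extract bs (ψ [ I ↦𝟙]) uniq Bⱼ∈) ⟩
  ψ I Bᵢ ⊗ ((ψ [ I ↦𝟙]) J Bⱼ ⊗ ∏ bs ((ψ [ I ↦𝟙]) [ J ↦𝟙]))
    ≈⟨ ⊗-cong (≈-trans (≈-reflexive (if-≡ᵇ-refl I)) (gen-component-at I (treeVertices r h) ℓ))
              (⊗-cong (≈-trans (≈-reflexive (trans (if-≡ᵇ-≢ (i≢j ∘ sym)) (if-≡ᵇ-≢ (i≢j ∘ sym)))) (gen-component J (treeVertices r′ h′)))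
                      (∏-cong bs others)) ⟩
  IndAt ℓ (treeVertices r h) ⊗ (Ind (treeVertices r′ h′) ⊗ Others F I J) ∎
  where
  open ≈-Reasoning
  I J : ℕ
  I = toℕ i
  J = toℕ j
  bs : List (Block Vertex)
  bs = componentBlocks 0 F
  uniq : Unique (labels bs)
  uniq = unique-componentBlocks 0 F
  Bᵢ Bⱼ : List Vertex
  Bᵢ = map (I ,_) (treeVertices r h)
  Bⱼ = map (J ,_) (treeVertices r′ h′)
  Bᵢ∈ : (I , Bᵢ) ∈ bs
  Bᵢ∈ = componentBlock-∈ 0 F i Fi
  Bⱼ∈ : (J , Bⱼ) ∈ bs
  Bⱼ∈ = componentBlock-∈ 0 F j Fj
  ψ : ℕ → List Vertex → Poly
  ψ = Components.pointed (eqV (I , ℓ)) I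
  others : ∀ c B → ((ψ [ I ↦𝟙]) [ J ↦𝟙]) c B ≈ (((λ _ → gen Components.Admissible) [ I ↦𝟙]) [ J ↦𝟙]) c B
  others c B with c ≡ᵇ J | c ≡ᵇ I
  ... | true  | _     = ≈-refl
  ... | false | true  = ≈-refl
  ... | false | false = ≈-refl

numIndep-factor : ∀ F (i j : Fin (length F)) → toℕ i ≢ toℕ j → ∀ {r h r′ h′} → lookup F i ≡ (r , h) → lookup F j ≡ (r′ , h′) →
  ∀ k ℓ → numIndep F k (toℕ i , ℓ) ≡ coeff k (IndAt ℓ (treeVertices r h) ⊗ (Ind (treeVertices r′ h′) ⊗ Others F (toℕ i) (toℕ j)))
numIndep-factor F i j i≢j Fi Fj k ℓ =
  trans (numIndep-∏ F k (toℕ i , ℓ) (∈-map⁺ proj₁ (componentBlock-∈ 0 F i Fi)))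
        (coeff-cong k (∏-components-factor F i j i≢j Fi Fj ℓ))

coeff-≤ : ∀ k {a b c d O O′} → a ⊗ b ≲ c ⊗ d → O ≈ O′ → coeff k (a ⊗ (b ⊗ O)) ≤ coeff k (d ⊗ (c ⊗ O′))
coeff-≤ k {a} {b} {c} {d} {O} {O′} ab≲cd O≈O′ = coeff-mono k (≲-resp-≈
  (solve 3 (λ a b o → (a :* b) :* o := a :* (b :* o)) ≈-refl a b O)
  (≈-trans (⊗-congˡ (c ⊗ d) O≈O′) (solve 3 (λ c d o → (c :* d) :* o := d :* (c :* o)) ≈-refl c d O′))
  (⊗-monoˡ-≲ O ab≲cd))

numIndep-≤ : ∀ F (i j : Fin (length F)) → toℕ i ≢ toℕ j → ∀ {r h r′ h′} → lookup F i ≡ (r , h) → lookup F j ≡ (r′ , h′) →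
  ∀ k ℓ ℓ′ → IndAt ℓ (treeVertices r h) ⊗ Ind (treeVertices r′ h′) ≲ Ind (treeVertices r h) ⊗ IndAt ℓ′ (treeVertices r′ h′) →
  numIndep F k (toℕ i , ℓ) ≤ numIndep F k (toℕ j , ℓ′)
numIndep-≤ F i j i≢j {r} {h} {r′} {h′} Fi Fj k ℓ ℓ′ trees-≲ =
  subst₂ _≤_ (sym (numIndep-factor F i j i≢j Fi Fj k ℓ)) (sym (numIndep-factor F j i (i≢j ∘ sym) Fj Fi k ℓ′))
    (coeff-≤ k {IndAt ℓ (treeVertices r h)} {Ind (treeVertices r′ h′)} {Ind (treeVertices r h)} {IndAt ℓ′ (treeVertices r′ h′)}
             trees-≲ (Others-comm F (toℕ i) (toℕ j)))

lemma5 : (F : Forest) → All ValidComponent F →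
    (i j : Fin (length F)) (r h₁ h₂ : ℕ) →
    lookup F i ≡ (r , h₁) → lookup F j ≡ (r , h₂) → h₁ < h₂ →
    (ℓ₁ ℓ₂ : _) → IsLeaf r h₁ ℓ₁ → IsLeaf r h₂ ℓ₂ →
    (k : ℕ) → 1 ≤ k →
    (h₁ % 2 ≡ 0 → numIndep F k (toℕ i , ℓ₁) ≤ numIndep F k (toℕ j , ℓ₂)) ×
    (h₁ % 2 ≡ 1 → numIndep F k (toℕ i , ℓ₁) ≥ numIndep F k (toℕ j , ℓ₂))
lemma5 F _ i j r h₁ h₂ Fi Fj h₁<h₂ ℓ₁ ℓ₂ leaf₁ leaf₂ k _ =
  (λ h₁-even → numIndep-≤ F i j i≢j Fi Fj k ℓ₁ ℓ₂ (proj₁ trees h₁-even)) ,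
  (λ h₁-odd  → numIndep-≤ F j i (i≢j ∘ sym) Fj Fi k ℓ₂ ℓ₁ (proj₂ trees h₁-odd))
  where
  i≢j : toℕ i ≢ toℕ j
  i≢j eq with refl ← toℕ-injective eq = ℕP.<-irrefl (cong proj₂ (trans (sym Fi) Fj)) h₁<h₂
  trees = perfectTree-comparison h₁<h₂ leaf₁ leaf₂
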